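{- Let $S$ be a bipartite signed digraph of order $n$ in which every directed cycle is negative. Then $$\phi_S(z)=z^n+\sum_{j=1}^{\lfloor n/2\rfloor} c_{2j}(S)\,z^{n-2j},$$ where $c_{2j}(S)=|\pounds_{2j}|$ is the number of linear subsidigraphs of $S$ of order $2j$.
   Context: A signed digraph $S$ is a digraph (no loops or multiple arcs) with a sign $\pm1$ on each arc; its adjacency matrix $A(S)=(a_{ij})$ has $a_{ij}$ equal to the sign of the arc from $v_i$ to $v_j$ if it exists and $0$ otherwise, and $\phi_S(z)=\det(zI-A(S))$. $S$ is bipartite if its underlying digraph is bipartite. The sign of a directed cycle is the product of the signs of its arcs; a cycle is negative if its sign is $-1$. A linear subsidigraph is a subsidigraph in which every vertex has indegree and outdegree one (a vertex-disjoint union of directed cycles); its order is its number of vertices. -}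

module Defs where

open import Data.Nat as ℕ using (ℕ; zero; suc)
open import Data.Integer as ℤ using (ℤ; +_; -_; _*_; _+_)
open import Data.Fin as Fin using (Fin; zero; suc; toℕ; punchIn)
open import Data.Fin.Properties using (all?; any?)
open import Data.List as List using (List; []; _∷_; map; concatMap; filter; length; foldr; allFin)
open import Data.Maybe using (Maybe; just; nothing; Is-just)
open import Data.Maybe.Relation.Unary.All as MAll using () renaming (All to MAll)
open import Data.Maybe.Relation.Unary.Any as MAny using ()
open import Data.Maybe.Properties using (≡-dec)
open import Data.Sign as Sign using (Sign)
open import Data.Bool using (Bool; if_then_else_)
open import Data.Product using (Σ; ∃; _×_; _,_)
open import Relation.Nullary using (¬_; Dec; does)
open import Relation.Nullary.Decidable using (_×-dec_; _→-dec_)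
open import Relation.Binary.PropositionalEquality using (_≡_; _≢_)

-- Signed digraphs on the vertex set Fin n (order n).
-- arc i j = just s : there is an arc v_i → v_j with sign s;
-- arc i j = nothing : no arc.  No loops.  (No multiple arcs by construction.)

record SignedDigraph (n : ℕ) : Set where
  field
    arc      : Fin n → Fin n → Maybe Sign
    loopless : ∀ i → arc i i ≡ nothing
open SignedDigraph public

Arc : ∀ {n} → SignedDigraph n → Fin n → Fin n → Set
Arc S i j = Is-just (arc S i j)

signToℤ : Sign → ℤ
signToℤ Sign.+ = + 1
signToℤ Sign.- = - (+ 1)

entry : Maybe Sign → ℤ
entry nothing  = + 0
entry (just s) = signToℤ s

adj : ∀ {n} → SignedDigraph n → Fin n → Fin n → ℤ
adj S i j = entry (arc S i j)

Bipartite : ∀ {n} → SignedDigraph n → Set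
Bipartite {n} S = Σ (Fin n → Bool) λ col → ∀ i j → Arc S i j → col i ≢ col j

-- A directed cycle of length suc m (m ≥ 1) is given by an
-- injective sequence of vertices c 0, …, c m with arcs c i → c (next i),
-- where next is the cyclic successor on Fin (suc m).

next : ∀ {m} → Fin (suc m) → Fin (suc m)
next {zero}  zero = zero
next {suc m} zero = suc zero
next {suc m} (suc i) with next i
... | zero  = zero
... | suc j = suc (suc j)

prodFin : ∀ {k} → (Fin k → ℤ) → ℤ
prodFin {k} f = foldr _*_ (+ 1) (map f (allFin k))

record DirectedCycle {n} (S : SignedDigraph n) : Set where
  field
    len-2    : ℕ
    vertex   : Fin (suc (suc len-2)) → Fin n
    distinct : ∀ i j → vertex i ≡ vertex j → i ≡ j
    arcs     : ∀ i → Arc S (vertex i) (vertex (next i))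
open DirectedCycle public

cycleSign : ∀ {n} {S : SignedDigraph n} → DirectedCycle S → ℤ
cycleSign {S = S} C = prodFin (λ i → adj S (vertex C i) (vertex C (next i)))

AllCyclesNegative : ∀ {n} → SignedDigraph n → Set
AllCyclesNegative S = ∀ (C : DirectedCycle S) → cycleSign C ≡ - (+ 1)

-- A linear subsidigraph L is encoded by its partial
-- successor map σ : σ i = just j iff i ∈ V(L) and (i → j) is the unique arc of
-- L leaving i; σ i = nothing iff i ∉ V(L).  The conditions say: every
-- chosen pair is an arc of S whose head lies in V(L) (so L is a subsidigraph
-- with outdegree 1 at each vertex), heads are distinct (indegree ≤ 1) and
-- every vertex of L is a head (indegree ≥ 1).

IsLinear : ∀ {n} → SignedDigraph n → (Fin n → Maybe (Fin n)) → Set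
IsLinear {n} S σ =
    (∀ i → MAll (λ j → Arc S i j × Is-just (σ j)) (σ i))
  × (∀ i i′ → Is-just (σ i) → σ i ≡ σ i′ → i ≡ i′)
  × (∀ i → Is-just (σ i) → ∃ λ i′ → σ i′ ≡ just i)

isJust? : ∀ {A : Set} (x : Maybe A) → Dec (Is-just x)
isJust? x = MAny.dec (λ _ → Relation.Nullary.yes Data.Unit.tt) x
  where import Data.Unit

isLinear? : ∀ {n} (S : SignedDigraph n) σ → Dec (IsLinear S σ)
isLinear? {n} S σ =
      all? (λ i → MAll.dec (λ j → isJust? (arc S i j) ×-dec isJust? (σ j)) (σ i))
  ×-dec all? (λ i → all? (λ i′ → isJust? (σ i) →-dec (≡-dec Fin._≟_ (σ i) (σ i′) →-dec (i Fin.≟ i′))))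
  ×-dec all? (λ i → isJust? (σ i) →-dec any? (λ i′ → ≡-dec Fin._≟_ (σ i′) (just i)))

order : ∀ {n} → (Fin n → Maybe (Fin n)) → ℕ
order {n} σ = length (filter (λ i → isJust? (σ i)) (allFin n))

consF : ∀ {k} {A : Set} → A → (Fin k → A) → Fin (suc k) → A
consF a f zero    = a
consF a f (suc i) = f i

allMaps : ∀ {A : Set} (k : ℕ) → List A → List (Fin k → A)
allMaps zero    xs = (λ ()) ∷ []
allMaps (suc k) xs = concatMap (λ a → map (consF a) (allMaps k xs)) xs

allMaybeFin : ∀ n → List (Maybe (Fin n))
allMaybeFin n = nothing ∷ map just (allFin n)

numLinear : ∀ {n} → SignedDigraph n → ℕ → ℕ
numLinear {n} S m =
  length (filter (λ σ → isLinear? S σ ×-dec (order σ ℕ.≟ m)) (allMaps n (allMaybeFin n)))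

-- Polynomials in ℤ[z] as coefficient lists (constant term first).

Poly : Set
Poly = List ℤ

_+P_ : Poly → Poly → Poly
[]      +P q       = q
(a ∷ p) +P []      = a ∷ p
(a ∷ p) +P (b ∷ q) = (a + b) ∷ (p +P q)

scaleP : ℤ → Poly → Poly
scaleP a = map (a *_)

_*P_ : Poly → Poly → Poly
[]      *P q = []
(a ∷ p) *P q = scaleP a q +P (+ 0 ∷ (p *P q))

negP : Poly → Poly
negP = map -_

coeff : Poly → ℕ → ℤ
coeff []      k       = + 0
coeff (a ∷ p) zero    = a
coeff (a ∷ p) (suc k) = coeff p k

det : ∀ n → (Fin n → Fin n → Poly) → Poly
det zero    M = + 1 ∷ []
det (suc n) M =
  foldr _+P_ []
    (map (λ j → scaleP ((- (+ 1)) ℤ.^ toℕ j)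
                  (M zero j *P det n (λ i k → M (suc i) (punchIn j k))))
         (allFin (suc n)))

zI-A : ∀ {n} → SignedDigraph n → Fin n → Fin n → Poly
zI-A S i j =
  (if does (i Fin.≟ j) then (+ 0 ∷ + 1 ∷ []) else []) +P negP (adj S i j ∷ [])

charPoly : ∀ {n} → SignedDigraph n → Poly
charPoly {n} S = det n (zI-A S)

-- Expanding det (zI − A) by the Leibniz formula, the coefficient of z^k is a signed sum over the
-- permutations π with k fixed points of sgn π · ∏ (−a_{t,πt}) over the moved points t. A term is nonzero
-- only if each moved point t has an arc t → πt, i.e. the moved points carry a linear subdigraph whose
-- cycles are those of π. A cycle of length ℓ contributes (−1)^(ℓ−1) to sgn π and (−1)^ℓ times its own
-- sign to the product, hence 1 when the cycle is negative; so the coefficient of z^k is the number of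
-- linear subdigraphs of order n − k. In a bipartite digraph the cycles alternate between the two colour
-- classes, so these orders are even.
--
-- The Laplace expansion defining det is unfolded into the Leibniz formula over Lehmer codes, and the
-- cycles are peeled off one at a time by induction on the number of moved points.

module Submission where

open import Data.Nat as ℕ using (ℕ; zero; suc; _+_; _*_; _∸_; _≤_; _<_; z≤n; s≤s)
import Data.Nat.Properties as ℕ
open import Data.Nat.GeneralisedArithmetic using (fold; fold-+)
open import Data.Nat.Induction using (<-rec; <-wellFounded)
open import Data.Integer as ℤ using (ℤ; 0ℤ; 1ℤ; -1ℤ; -_)
import Data.Integer.Properties as ℤ
open import Data.Integer.Tactic.RingSolver using (solve-∀)
open import Data.Fin as Fin using (Fin; zero; suc; toℕ; punchIn; punchOut; fromℕ)
import Data.Fin.Properties as Fin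
import Data.Fin.Permutation as Perm
open import Data.Fin.Permutation.Components using (transpose)
open import Data.Bool using (Bool; true; false; not)
open import Data.Bool.Properties using (¬-not; not-involutive)
open import Data.Sign using (Sign)
open import Data.Maybe using (Maybe; just; nothing; Is-just; fromMaybe)
import Data.Maybe.Properties as Maybe
import Data.Maybe.Relation.Unary.All as MaybeAll
open import Data.Maybe.Relation.Unary.Any using (just)
open import Data.List using (List; []; _∷_; _++_; map; concatMap; foldr; tabulate; allFin; length; filter)
open import Data.Unit using (⊤; tt)
open import Data.Product using (∃; _×_; _,_; proj₁; proj₂)
open import Data.Sum using (_⊎_; inj₁; inj₂)
open import Data.Empty using (⊥-elim)
open import Relation.Nullary using (¬_; Dec; yes; no)
open import Relation.Nullary.Decidable using (¬?; _×-dec_; _→-dec_; dec-true; dec-false; decidable-stable)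
open import Relation.Unary using (Decidable)
open import Relation.Binary using (DecidableEquality; tri<; tri≈; tri>)
open import Relation.Binary.PropositionalEquality using (_≡_; _≢_; refl; sym; trans; cong; cong₂; subst; subst₂; module ≡-Reasoning)
import Relation.Binary.Construct.On as On
open import Induction.WellFounded using (module All)
open import Function using (_∘_; id)
open import Function.Definitions using (Injective)
open import Level using (0ℓ)
open import Algebra.Bundles using (Semiring)
import Algebra.Properties.CommutativeSemigroup ℤ.*-commutativeSemigroup as ℤ*
import Algebra.Properties.Semiring.Sum as SemiringSum
open import Algebra.Properties.Semiring.Sum ℕ.+-*-semiring using (sum; sum-cong-≗; ∑-distrib-+; ∑-comm; sum-permute; sum-replicate-zero)
open import Algebra.Properties.Semiring.Sum ℤ.+-*-semiring using () renaming (sum to ∑; sum-cong-≗ to ∑-cong)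
open import Algebra.Properties.CommutativeMonoid.Sum ℤ.*-1-commutativeMonoid
  using () renaming (sum to ∏; sum-cong-≗ to ∏-cong; ∑-distrib-+ to ∏-distrib-*; sum-remove to ∏-remove; sum-replicate-zero to ∏-replicate-one)
open import Defs

private
  variable
    A B : Set

𝟙 : ∀ {p} {A : Set p} → Dec A → ℕ
𝟙 (yes _) = 1
𝟙 (no _) = 0

𝟙-yes : ∀ {A : Set} → A → (d : Dec A) → 𝟙 d ≡ 1
𝟙-yes a (yes _) = refl
𝟙-yes a (no ¬a) = ⊥-elim (¬a a)

𝟙-no : ∀ {A : Set} → ¬ A → (d : Dec A) → 𝟙 d ≡ 0
𝟙-no ¬a (yes a) = ⊥-elim (¬a a)
𝟙-no ¬a (no _) = refl

𝟙-cong : ∀ {A B : Set} → (A → B) → (B → A) → (d : Dec A) (d′ : Dec B) → 𝟙 d ≡ 𝟙 d′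
𝟙-cong f g (yes a) (yes b) = refl
𝟙-cong f g (yes a) (no ¬b) = ⊥-elim (¬b (f a))
𝟙-cong f g (no ¬a) (yes b) = ⊥-elim (¬a (g b))
𝟙-cong f g (no ¬a) (no ¬b) = refl

𝟙-× : ∀ {A B C : Set} → (A → B × C) → (B × C → A) → (a? : Dec A) (b? : Dec B) (c? : Dec C) → 𝟙 a? ≡ 𝟙 b? * 𝟙 c?
𝟙-× to from (yes a) (yes b) (yes c) = refl
𝟙-× to from (yes a) (yes b) (no ¬c) = ⊥-elim (¬c (proj₂ (to a)))
𝟙-× to from (yes a) (no ¬b) c? = ⊥-elim (¬b (proj₁ (to a)))
𝟙-× to from (no ¬a) (yes b) (yes c) = ⊥-elim (¬a (from (b , c)))
𝟙-× to from (no ¬a) (yes b) (no _) = refl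
𝟙-× to from (no ¬a) (no _) c? = refl

sum-zero : ∀ {n} (f : Fin n → ℕ) → (∀ i → f i ≡ 0) → sum f ≡ 0
sum-zero {n} f f≗0 = trans (sum-cong-≗ f≗0) (sum-replicate-zero n)

-- Signs of permutations

-- Permutations of Fin n are handled as injective functions Fin n → Fin n.
Inj : ∀ {m n} → (Fin m → Fin n) → Set
Inj = Injective _≡_ _≡_

∘-inj : ∀ {n} {f g : Fin n → Fin n} → Inj f → Inj g → Inj (f ∘ g)
∘-inj f-inj g-inj = g-inj ∘ f-inj

≗-inj : ∀ {n} {f g : Fin n → Fin n} → (∀ x → f x ≡ g x) → Inj g → Inj f
≗-inj {f = f} {g} f≗g g-inj {x} {y} eq = g-inj (trans (sym (f≗g x)) (trans eq (f≗g y)))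

inj⇒surj : ∀ {n} (f : Fin n → Fin n) → Inj f → ∀ t → ∃ λ i → f i ≡ t
inj⇒surj {zero} f inj ()
inj⇒surj {suc m} f inj t with Fin.any? (λ i → f i Fin.≟ t)
... | yes p = p
... | no ∄i = ⊥-elim (ℕ.1+n≰n (Fin.injective⇒≤ {f = g} g-inj))
  where
  g : Fin (suc m) → Fin m
  g i = punchOut {i = t} {j = f i} (λ eq → ∄i (i , sym eq))
  g-inj : Inj g
  g-inj {x} {y} eq = inj (Fin.punchOut-injective (λ e → ∄i (x , sym e)) (λ e → ∄i (y , sym e)) eq)

sum-reindex : ∀ {n} (g : Fin n → ℕ) (f : Fin n → Fin n) → Inj f → sum g ≡ sum (g ∘ f)
sum-reindex g f inj = sum-permute g (Perm.permutation f f⁻¹ (λ y → proj₂ (inj⇒surj f inj y)) (λ x → inj (proj₂ (inj⇒surj f inj (f x)))))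
  where
  f⁻¹ : Fin _ → Fin _
  f⁻¹ y = proj₁ (inj⇒surj f inj y)

∑∑ : ∀ {n} → (Fin n → Fin n → ℕ) → ℕ
∑∑ f = sum λ i → sum (f i)

∑∑-cong : ∀ {n} {f g : Fin n → Fin n → ℕ} → (∀ i j → f i j ≡ g i j) → ∑∑ f ≡ ∑∑ g
∑∑-cong f≗g = sum-cong-≗ λ i → sum-cong-≗ (f≗g i)

∑∑-distrib-+ : ∀ {n} (f g : Fin n → Fin n → ℕ) → ∑∑ (λ i j → f i j + g i j) ≡ ∑∑ f + ∑∑ g
∑∑-distrib-+ f g = trans (sum-cong-≗ λ i → ∑-distrib-+ (f i) (g i)) (∑-distrib-+ (λ i → sum (f i)) (λ i → sum (g i)))

[_<_] : ∀ {n} → Fin n → Fin n → ℕ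
[ i < j ] = 𝟙 (i Fin.<? j)

[<]-irrefl : ∀ {n} (i : Fin n) → [ i < i ] ≡ 0
[<]-irrefl i = 𝟙-no (Fin.<-irrefl refl) (i Fin.<? i)

OneOf : ℕ → ℕ → Set
OneOf x y = (x ≡ 1 × y ≡ 0) ⊎ (x ≡ 0 × y ≡ 1)

[<]-oneOf : ∀ {n} {a b : Fin n} → a ≢ b → OneOf [ a < b ] [ b < a ]
[<]-oneOf {a = a} {b} a≢b with Fin.<-cmp a b
... | tri< a<b _ _ = inj₁ (𝟙-yes a<b (a Fin.<? b) , 𝟙-no (Fin.<-asym a<b) (b Fin.<? a))
... | tri≈ _ a≡b _ = ⊥-elim (a≢b a≡b)
... | tri> _ _ b<a = inj₂ (𝟙-no (Fin.<-asym b<a) (a Fin.<? b) , 𝟙-yes b<a (b Fin.<? a))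

[<]-asym : ∀ {n} (a b : Fin n) → [ a < b ] * [ b < a ] ≡ 0
[<]-asym a b with a Fin.≟ b
... | yes refl = cong (_* [ a < a ]) ([<]-irrefl a)
... | no a≢b with [<]-oneOf a≢b
...   | inj₁ (_ , l′≡0) = trans (cong ([ a < b ] *_) l′≡0) (ℕ.*-zeroʳ [ a < b ])
...   | inj₂ (l≡0 , _) = cong (_* [ b < a ]) l≡0

∑∑-symmetric : ∀ {n} (f : Fin n → Fin n → ℕ) → (∀ i j → f i j ≡ f j i) → (∀ i → f i i ≡ 0) →
  ∑∑ (λ i j → [ i < j ] * f i j) + ∑∑ (λ i j → [ i < j ] * f i j) ≡ ∑∑ f
∑∑-symmetric f sym-f diag-f = begin
  ∑∑ (λ i j → [ i < j ] * f i j) + ∑∑ (λ i j → [ i < j ] * f i j)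
    ≡⟨ cong (∑∑ (λ i j → [ i < j ] * f i j) +_) (∑-comm λ i j → [ i < j ] * f i j) ⟩
  ∑∑ (λ i j → [ i < j ] * f i j) + ∑∑ (λ i j → [ j < i ] * f j i)
    ≡⟨ ∑∑-distrib-+ (λ i j → [ i < j ] * f i j) (λ i j → [ j < i ] * f j i) ⟨
  ∑∑ (λ i j → [ i < j ] * f i j + [ j < i ] * f j i)
    ≡⟨ ∑∑-cong split ⟩
  ∑∑ f ∎
  where
  open ≡-Reasoning
  split : ∀ i j → [ i < j ] * f i j + [ j < i ] * f j i ≡ f i j
  split i j with i Fin.≟ j
  ... | yes refl rewrite [<]-irrefl i | diag-f i = refl
  ... | no i≢j with [<]-oneOf i≢j
  ...   | inj₁ (l≡1 , l′≡0) rewrite l≡1 | l′≡0 = trans (ℕ.+-identityʳ (f i j + 0)) (ℕ.+-identityʳ (f i j))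
  ...   | inj₂ (l≡0 , l′≡1) rewrite l≡0 | l′≡1 = trans (ℕ.+-identityʳ (f j i)) (sym (sym-f i j))

inversions : ∀ {n} → (Fin n → Fin n) → ℕ
inversions π = ∑∑ λ i j → [ i < j ] * [ π j < π i ]

sgn : ∀ {n} → (Fin n → Fin n) → ℤ
sgn π = -1ℤ ℤ.^ inversions π

-1^-double : ∀ m → -1ℤ ℤ.^ (m + m) ≡ 1ℤ
-1^-double m = begin
  -1ℤ ℤ.^ (m + m)   ≡⟨ cong (-1ℤ ℤ.^_) (cong (m +_) (ℕ.+-identityʳ m)) ⟨
  -1ℤ ℤ.^ (2 * m)   ≡⟨ ℤ.^-*-assoc -1ℤ 2 m ⟨
  1ℤ ℤ.^ m          ≡⟨ ℤ.^-zeroˡ m ⟩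
  1ℤ ∎
  where open ≡-Reasoning

sgn-cong : ∀ {n} {π ρ : Fin n → Fin n} → (∀ i → π i ≡ ρ i) → sgn π ≡ sgn ρ
sgn-cong π≗ρ = cong (λ m → -1ℤ ℤ.^ m) (∑∑-cong λ i j → cong ([ i < j ] *_) (cong₂ [_<_] (π≗ρ j) (π≗ρ i)))

-- A pair i < j is an inversion of α ∘ β iff exactly one of β and α (on the pair {β i, β j}) reverses it,
-- so inversions (α ∘ β) = inversions β + inversions α − 2 · #(pairs reversed by both).
module _ {n} {α β : Fin n → Fin n} (α-inj : Inj α) (β-inj : Inj β) where

  private
    flip : Fin n → Fin n → ℕ
    flip a b = [ a < b ] * [ α b < α a ] + [ b < a ] * [ α a < α b ]

    flipβ : Fin n → Fin n → ℕ
    flipβ i j = flip (β i) (β j)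

    ∑∑-flip : ∑∑ flip ≡ inversions α + inversions α
    ∑∑-flip = trans (∑∑-distrib-+ (λ a b → [ a < b ] * [ α b < α a ]) (λ a b → [ b < a ] * [ α a < α b ]))
                    (cong (inversions α +_) (∑-comm λ a b → [ b < a ] * [ α a < α b ]))

    both-flipped : ℕ
    both-flipped = ∑∑ λ i j → [ i < j ] * [ β j < β i ] * flipβ i j

    pair-identity : ∀ {l p p′ q q′} → l ≡ 0 ⊎ (l ≡ 1 × OneOf p p′ × OneOf q q′) →
      l * q + (l * p * (p′ * q + p * q′) + l * p * (p′ * q + p * q′)) ≡ l * p + l * (p′ * q + p * q′)
    pair-identity (inj₁ refl) = refl
    pair-identity (inj₂ (refl , inj₁ (refl , refl) , inj₁ (refl , refl))) = refl
    pair-identity (inj₂ (refl , inj₁ (refl , refl) , inj₂ (refl , refl))) = refl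
    pair-identity (inj₂ (refl , inj₂ (refl , refl) , inj₁ (refl , refl))) = refl
    pair-identity (inj₂ (refl , inj₂ (refl , refl) , inj₂ (refl , refl))) = refl

    pair-cases : ∀ i j → [ i < j ] ≡ 0 ⊎ ([ i < j ] ≡ 1
      × OneOf [ β j < β i ] [ β i < β j ] × OneOf [ α (β j) < α (β i) ] [ α (β i) < α (β j) ])
    pair-cases i j with i Fin.<? j
    ... | no _ = inj₁ refl
    ... | yes i<j = inj₂ (refl , [<]-oneOf (i≢j ∘ sym ∘ β-inj) , [<]-oneOf (i≢j ∘ sym ∘ β-inj ∘ α-inj))
      where i≢j = Fin.<⇒≢ i<j

    ∑∑-flipβ : ∑∑ flipβ ≡ ∑∑ flip
    ∑∑-flipβ = trans (sum-cong-≗ λ i → sym (sum-reindex (flip (β i)) β β-inj)) (sym (sum-reindex (λ a → sum (flip a)) β β-inj))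

    once-flipped≡inversions : ∑∑ (λ i j → [ i < j ] * flipβ i j) ≡ inversions α
    once-flipped≡inversions = ℕ.*-cancelˡ-≡ _ _ 2 (begin
      2 * ∑∑ (λ i j → [ i < j ] * flipβ i j)
        ≡⟨ cong (∑∑ (λ i j → [ i < j ] * flipβ i j) +_) (ℕ.+-identityʳ _) ⟩
      ∑∑ (λ i j → [ i < j ] * flipβ i j) + ∑∑ (λ i j → [ i < j ] * flipβ i j)
        ≡⟨ ∑∑-symmetric flipβ (λ i j → ℕ.+-comm ([ β i < β j ] * [ α (β j) < α (β i) ]) _) (λ i → cong₂ _+_ (zero-term i) (zero-term i)) ⟩
      ∑∑ flipβ                     ≡⟨ trans ∑∑-flipβ ∑∑-flip ⟩
      inversions α + inversions α  ≡⟨ cong (inversions α +_) (ℕ.+-identityʳ _) ⟨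
      2 * inversions α ∎)
      where
      open ≡-Reasoning
      zero-term : ∀ i → [ β i < β i ] * [ α (β i) < α (β i) ] ≡ 0
      zero-term i = cong (_* [ α (β i) < α (β i) ]) ([<]-irrefl (β i))

    inversions-∘-parity : inversions (α ∘ β) + (both-flipped + both-flipped) ≡ inversions β + inversions α
    inversions-∘-parity = begin
      inversions (α ∘ β) + (both-flipped + both-flipped)
        ≡⟨ cong (inversions (α ∘ β) +_) (∑∑-distrib-+ twice twice) ⟨
      inversions (α ∘ β) + ∑∑ (λ i j → twice i j + twice i j)
        ≡⟨ ∑∑-distrib-+ (λ i j → [ i < j ] * [ α (β j) < α (β i) ]) (λ i j → twice i j + twice i j) ⟨
      ∑∑ (λ i j → [ i < j ] * [ α (β j) < α (β i) ] + (twice i j + twice i j))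
        ≡⟨ ∑∑-cong (λ i j → pair-identity (pair-cases i j)) ⟩
      ∑∑ (λ i j → [ i < j ] * [ β j < β i ] + [ i < j ] * flipβ i j)
        ≡⟨ ∑∑-distrib-+ (λ i j → [ i < j ] * [ β j < β i ]) (λ i j → [ i < j ] * flipβ i j) ⟩
      inversions β + ∑∑ (λ i j → [ i < j ] * flipβ i j)
        ≡⟨ cong (inversions β +_) once-flipped≡inversions ⟩
      inversions β + inversions α ∎
      where
      open ≡-Reasoning
      twice : Fin n → Fin n → ℕ
      twice i j = [ i < j ] * [ β j < β i ] * flipβ i j

  sgn-∘ : sgn (α ∘ β) ≡ sgn α ℤ.* sgn β
  sgn-∘ = begin
    -1ℤ ℤ.^ inversions (α ∘ β)                                     ≡⟨ ℤ.*-identityʳ _ ⟨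
    -1ℤ ℤ.^ inversions (α ∘ β) ℤ.* 1ℤ                              ≡⟨ cong (-1ℤ ℤ.^ inversions (α ∘ β) ℤ.*_) (-1^-double both-flipped) ⟨
    -1ℤ ℤ.^ inversions (α ∘ β) ℤ.* -1ℤ ℤ.^ (both-flipped + both-flipped)
                                                                   ≡⟨ ℤ.^-distribˡ-+-* -1ℤ (inversions (α ∘ β)) _ ⟨
    -1ℤ ℤ.^ (inversions (α ∘ β) + (both-flipped + both-flipped))   ≡⟨ cong (-1ℤ ℤ.^_) inversions-∘-parity ⟩
    -1ℤ ℤ.^ (inversions β + inversions α)                          ≡⟨ ℤ.^-distribˡ-+-* -1ℤ (inversions β) (inversions α) ⟩
    sgn β ℤ.* sgn α                                                ≡⟨ ℤ.*-comm (sgn β) (sgn α) ⟩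
    sgn α ℤ.* sgn β ∎
    where open ≡-Reasoning

sgn-id : ∀ {n} {π : Fin n → Fin n} → (∀ t → π t ≡ t) → sgn π ≡ 1ℤ
sgn-id {n} {π} π≗id = trans (sgn-cong π≗id) (cong (-1ℤ ℤ.^_) inversions-id)
  where
  inversions-id : inversions {n} id ≡ 0
  inversions-id = sum-zero {n} (λ i → sum λ j → [ i < j ] * [ j < i ]) λ i → sum-zero (λ j → [ i < j ] * [ j < i ]) λ j → [<]-asym i j

module _ {n} (a b : Fin n) where

  transpose-left : transpose a b a ≡ b
  transpose-left rewrite dec-true (a Fin.≟ a) refl = refl

  transpose-right : transpose a b b ≡ a
  transpose-right = by-cases (b Fin.≟ a)
    where
    by-cases : Dec (b ≡ a) → transpose a b b ≡ a
    by-cases (yes refl) = transpose-left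
    by-cases (no b≢a) rewrite dec-false (b Fin.≟ a) b≢a | dec-true (b Fin.≟ b) refl = refl

  transpose-other : ∀ {t} → t ≢ a → t ≢ b → transpose a b t ≡ t
  transpose-other {t} t≢a t≢b rewrite dec-false (t Fin.≟ a) t≢a | dec-false (t Fin.≟ b) t≢b = refl

  transpose-involutive : ∀ t → transpose a b (transpose a b t) ≡ t
  transpose-involutive t = by-cases (t Fin.≟ a) (t Fin.≟ b)
    where
    by-cases : Dec (t ≡ a) → Dec (t ≡ b) → transpose a b (transpose a b t) ≡ t
    by-cases (yes refl) _ = trans (cong (transpose a b) transpose-left) transpose-right
    by-cases (no _) (yes refl) = trans (cong (transpose a b) transpose-right) transpose-left
    by-cases (no t≢a) (no t≢b) = trans (cong (transpose a b) (transpose-other t≢a t≢b)) (transpose-other t≢a t≢b)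

  transpose-inj : Inj (transpose a b)
  transpose-inj {x} {y} eq = trans (sym (transpose-involutive x)) (trans (cong (transpose a b) eq) (transpose-involutive y))

transpose-conj : ∀ {n} {σ σ′ : Fin n → Fin n} → (∀ t → σ (σ′ t) ≡ t) → (∀ t → σ′ (σ t) ≡ t) →
  ∀ x y t → σ (transpose x y (σ′ t)) ≡ transpose (σ x) (σ y) t
transpose-conj {σ = σ} {σ′} σσ′ σ′σ x y t = by-cases (t Fin.≟ σ x) (t Fin.≟ σ y)
  where
  by-cases : Dec (t ≡ σ x) → Dec (t ≡ σ y) → σ (transpose x y (σ′ t)) ≡ transpose (σ x) (σ y) t
  by-cases (yes refl) _ = trans (cong σ (trans (cong (transpose x y) (σ′σ x)) (transpose-left x y)))
                                 (sym (transpose-left (σ x) (σ y)))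
  by-cases (no _) (yes refl) = trans (cong σ (trans (cong (transpose x y) (σ′σ y)) (transpose-right x y)))
                                      (sym (transpose-right (σ x) (σ y)))
  by-cases (no t≢σx) (no t≢σy) =
    trans (cong σ (transpose-other x y σ′t≢x σ′t≢y)) (trans (σσ′ t) (sym (transpose-other (σ x) (σ y) t≢σx t≢σy)))
    where
    σ′t≢x : σ′ t ≢ x
    σ′t≢x eq = t≢σx (trans (sym (σσ′ t)) (cong σ eq))
    σ′t≢y : σ′ t ≢ y
    σ′t≢y eq = t≢σy (trans (sym (σσ′ t)) (cong σ eq))

inversions-transpose01 : ∀ {m} → inversions (transpose {suc (suc m)} zero (suc zero)) ≡ 1
inversions-transpose01 {m} = cong₂ _+_ row0 (cong₂ _+_ row1 rows)
  where
  τ : Fin (suc (suc m)) → Fin (suc (suc m))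
  τ = transpose zero (suc zero)
  row0 : sum (λ j → [ zero < j ] * [ τ j < τ zero ]) ≡ 1
  row0 = cong suc (sum-zero {m} _ λ _ → refl)
  row1 : sum (λ j → [ suc zero < j ] * [ τ j < τ (suc zero) ]) ≡ 0
  row1 = sum-zero {suc (suc m)} _ λ j → ℕ.*-zeroʳ [ suc zero < j ]
  rows : sum (λ (i : Fin m) → sum λ j → [ suc (suc i) < j ] * [ τ j < τ (suc (suc i)) ]) ≡ 0
  rows = sum-zero _ λ i → sum-zero (λ j → [ suc (suc i) < j ] * [ τ j < τ (suc (suc i)) ]) λ
    { zero → refl ; (suc zero) → refl ; (suc (suc j)) → [<]-asym (suc (suc i)) (suc (suc j)) }

-- σ sends 0, 1 to a, b, so transpose a b is the conjugate σ ∘ transpose 0 1 ∘ σ⁻¹.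
sgn-transpose : ∀ {n} {a b : Fin n} → a ≢ b → sgn (transpose a b) ≡ -1ℤ
sgn-transpose {suc zero} {zero} {zero} a≢b = ⊥-elim (a≢b refl)
sgn-transpose {suc (suc m)} {a} {b} a≢b = begin
  sgn (transpose a b)                      ≡⟨ sgn-cong (λ t → trans (conj t) (cong₂ (λ x y → transpose x y t) σ0 σ1)) ⟨
  sgn (σ ∘ (τ ∘ σ′))                      ≡⟨ sgn-∘ σ-inj (∘-inj (transpose-inj zero (suc zero)) σ′-inj) ⟩
  sgn σ ℤ.* sgn (τ ∘ σ′)                  ≡⟨ cong (sgn σ ℤ.*_) (sgn-∘ (transpose-inj zero (suc zero)) σ′-inj) ⟩
  sgn σ ℤ.* (sgn τ ℤ.* sgn σ′)           ≡⟨ ℤ*.x∙yz≈y∙xz (sgn σ) (sgn τ) (sgn σ′) ⟩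
  sgn τ ℤ.* (sgn σ ℤ.* sgn σ′)           ≡⟨ cong (sgn τ ℤ.*_) (trans (sym (sgn-∘ σ-inj σ′-inj)) (sgn-id σσ′)) ⟩
  sgn τ ℤ.* 1ℤ                            ≡⟨ ℤ.*-identityʳ (sgn τ) ⟩
  sgn τ                                   ≡⟨ cong (-1ℤ ℤ.^_) (inversions-transpose01 {m}) ⟩
  -1ℤ ∎
  where
  open ≡-Reasoning
  τ : Fin (suc (suc m)) → Fin (suc (suc m))
  τ = transpose zero (suc zero)
  c : Fin (suc (suc m))
  c = transpose zero a b
  σ σ′ : Fin (suc (suc m)) → Fin (suc (suc m))
  σ = transpose zero a ∘ transpose (suc zero) c
  σ′ = transpose (suc zero) c ∘ transpose zero a
  σ-inj : Inj σ
  σ-inj = ∘-inj (transpose-inj zero a) (transpose-inj (suc zero) c)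
  σ′-inj : Inj σ′
  σ′-inj = ∘-inj (transpose-inj (suc zero) c) (transpose-inj zero a)
  σσ′ : ∀ t → σ (σ′ t) ≡ t
  σσ′ t = trans (cong (transpose zero a) (transpose-involutive (suc zero) c (transpose zero a t))) (transpose-involutive zero a t)
  σ′σ : ∀ t → σ′ (σ t) ≡ t
  σ′σ t = trans (cong (transpose (suc zero) c) (transpose-involutive zero a (transpose (suc zero) c t))) (transpose-involutive (suc zero) c t)
  conj : ∀ t → σ (τ (σ′ t)) ≡ transpose (σ zero) (σ (suc zero)) t
  conj = transpose-conj {σ = σ} {σ′} σσ′ σ′σ zero (suc zero)
  c≢0 : c ≢ zero
  c≢0 c≡0 = a≢b (sym (trans (sym (transpose-involutive zero a b)) (trans (cong (transpose zero a) c≡0) (transpose-left zero a))))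
  σ0 : σ zero ≡ a
  σ0 = trans (cong (transpose zero a) (transpose-other (suc zero) c (λ ()) (c≢0 ∘ sym))) (transpose-left zero a)
  σ1 : σ (suc zero) ≡ b
  σ1 = trans (cong (transpose zero a) (transpose-left (suc zero) c)) (transpose-involutive zero a b)

cyclic : ∀ {m n} → (Fin (suc m) → Fin n) → Fin n → Fin n
cyclic e t with Fin.any? (λ i → e i Fin.≟ t)
... | yes (i , _) = e (next i)
... | no _ = t

cyclic-on : ∀ {m n} {e : Fin (suc m) → Fin n} → Inj e → ∀ i → cyclic e (e i) ≡ e (next i)
cyclic-on {e = e} e-inj i with Fin.any? (λ k → e k Fin.≟ e i)
... | yes (k , ek≡ei) = cong (e ∘ next) (e-inj ek≡ei)
... | no ∄k = ⊥-elim (∄k (i , refl))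

cyclic-off : ∀ {m n} {e : Fin (suc m) → Fin n} {t} → (∀ i → e i ≢ t) → cyclic e t ≡ t
cyclic-off {e = e} {t} t∉e with Fin.any? (λ k → e k Fin.≟ t)
... | yes (k , ek≡t) = ⊥-elim (t∉e k ek≡t)
... | no _ = refl

next-suc-zero : ∀ {m} {i : Fin (suc m)} → next i ≡ zero → next {suc m} (suc i) ≡ zero
next-suc-zero eq rewrite eq = refl

next-suc-suc : ∀ {m} {i : Fin (suc m)} {j} → next i ≡ suc j → next {suc m} (suc i) ≡ suc (suc j)
next-suc-suc eq rewrite eq = refl

cyclic-split : ∀ {m n} {e : Fin (suc (suc m)) → Fin n} → Inj e →
  ∀ t → cyclic e t ≡ transpose (e zero) (e (suc zero)) (cyclic (e ∘ suc) t)
cyclic-split {m} {n} {e} e-inj t = by-cases (Fin.any? (λ i → e i Fin.≟ t))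
  where
  τ : Fin n → Fin n
  τ = transpose (e zero) (e (suc zero))
  e∘suc-inj : Inj (e ∘ suc)
  e∘suc-inj = Fin.suc-injective ∘ e-inj
  by-cases : Dec (∃ λ i → e i ≡ t) → cyclic e t ≡ τ (cyclic (e ∘ suc) t)
  by-cases (yes (zero , refl)) = begin
    cyclic e (e zero)                ≡⟨ cyclic-on e-inj zero ⟩
    e (suc zero)                     ≡⟨ transpose-left (e zero) (e (suc zero)) ⟨
    τ (e zero)                       ≡⟨ cong τ (cyclic-off (λ i eq → Fin.0≢1+n (e-inj (sym eq)))) ⟨
    τ (cyclic (e ∘ suc) (e zero)) ∎
    where open ≡-Reasoning
  by-cases (yes (suc i , refl)) = begin
    cyclic e (e (suc i))              ≡⟨ cyclic-on e-inj (suc i) ⟩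
    e (next (suc i))                  ≡⟨ after-shift (next i) refl ⟨
    τ (e (suc (next i)))              ≡⟨ cong τ (cyclic-on e∘suc-inj i) ⟨
    τ (cyclic (e ∘ suc) (e (suc i))) ∎
    where
    open ≡-Reasoning
    after-shift : ∀ k → next i ≡ k → τ (e (suc k)) ≡ e (next (suc i))
    after-shift zero eq = trans (transpose-right (e zero) (e (suc zero))) (cong e (sym (next-suc-zero eq)))
    after-shift (suc j) eq = trans (transpose-other (e zero) (e (suc zero)) (Fin.0≢1+n ∘ sym ∘ e-inj) (Fin.0≢1+n ∘ sym ∘ e∘suc-inj))
                                   (cong e (sym (next-suc-suc eq)))
  by-cases (no t∉e) = begin
    cyclic e t                     ≡⟨ cyclic-off (λ i eq → t∉e (i , eq)) ⟩
    t                              ≡⟨ transpose-other (e zero) (e (suc zero)) (λ eq → t∉e (zero , sym eq)) (λ eq → t∉e (suc zero , sym eq)) ⟨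
    τ t                            ≡⟨ cong τ (cyclic-off (λ i eq → t∉e (suc i , eq))) ⟨
    τ (cyclic (e ∘ suc) t) ∎
    where open ≡-Reasoning

cyclic-inj-sgn : ∀ {n} m {e : Fin (suc m) → Fin n} → Inj e → Inj (cyclic e) × sgn (cyclic e) ≡ -1ℤ ℤ.^ m
cyclic-inj-sgn zero {e} e-inj = ≗-inj cyclic≗id (λ eq → eq) , sgn-id cyclic≗id
  where
  cyclic≗id : ∀ t → cyclic e t ≡ t
  cyclic≗id t with Fin.any? (λ i → e i Fin.≟ t)
  ... | yes (zero , e0≡t) = e0≡t
  ... | no _ = refl
cyclic-inj-sgn (suc m) {e} e-inj = ≗-inj (cyclic-split e-inj) τ∘cyclic-inj , (begin
  sgn (cyclic e)                                                  ≡⟨ sgn-cong (cyclic-split e-inj) ⟩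
  sgn (transpose (e zero) (e (suc zero)) ∘ cyclic (e ∘ suc))      ≡⟨ sgn-∘ (transpose-inj (e zero) (e (suc zero))) (proj₁ ih) ⟩
  sgn (transpose (e zero) (e (suc zero))) ℤ.* sgn (cyclic (e ∘ suc))
                                                                  ≡⟨ cong₂ ℤ._*_ (sgn-transpose (Fin.0≢1+n ∘ e-inj)) (proj₂ ih) ⟩
  -1ℤ ℤ.* -1ℤ ℤ.^ m ∎)
  where
  open ≡-Reasoning
  ih : Inj (cyclic (e ∘ suc)) × sgn (cyclic (e ∘ suc)) ≡ -1ℤ ℤ.^ m
  ih = cyclic-inj-sgn m (Fin.suc-injective ∘ e-inj)
  τ∘cyclic-inj : Inj (transpose (e zero) (e (suc zero)) ∘ cyclic (e ∘ suc))
  τ∘cyclic-inj = ∘-inj (transpose-inj (e zero) (e (suc zero))) (proj₁ ih)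

∏-one : ∀ {n} {f : Fin n → ℤ} → (∀ i → f i ≡ 1ℤ) → ∏ f ≡ 1ℤ
∏-one {n} f≗1 = trans (∏-cong f≗1) (∏-replicate-one n)

∏-neg : ∀ {n} (f : Fin n → ℤ) → ∏ (λ i → - f i) ≡ -1ℤ ℤ.^ n ℤ.* ∏ f
∏-neg {zero} f = refl
∏-neg {suc n} f = begin
  - f zero ℤ.* ∏ (λ i → - f (suc i))              ≡⟨ cong (- f zero ℤ.*_) (∏-neg (f ∘ suc)) ⟩
  - f zero ℤ.* (-1ℤ ℤ.^ n ℤ.* ∏ (f ∘ suc))        ≡⟨ ℤ*.x∙yz≈y∙xz (- f zero) (-1ℤ ℤ.^ n) (∏ (f ∘ suc)) ⟩
  -1ℤ ℤ.^ n ℤ.* (- f zero ℤ.* ∏ (f ∘ suc))        ≡⟨ cong (-1ℤ ℤ.^ n ℤ.*_) (ℤ.neg-distribˡ-* (f zero) (∏ (f ∘ suc))) ⟨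
  -1ℤ ℤ.^ n ℤ.* - (f zero ℤ.* ∏ (f ∘ suc))        ≡⟨ ℤ.neg-distribʳ-* (-1ℤ ℤ.^ n) (∏ f) ⟨
  - (-1ℤ ℤ.^ n ℤ.* ∏ f)                            ≡⟨ ℤ.-1*i≡-i (-1ℤ ℤ.^ n ℤ.* ∏ f) ⟨
  -1ℤ ℤ.* (-1ℤ ℤ.^ n ℤ.* ∏ f)                      ≡⟨ ℤ.*-assoc -1ℤ (-1ℤ ℤ.^ n) (∏ f) ⟨
  -1ℤ ℤ.^ suc n ℤ.* ∏ f ∎
  where open ≡-Reasoning

∏-image : ∀ {L n} {e : Fin L → Fin n} → Inj e → (g : Fin n → ℤ) →
  (∀ t → (∀ i → e i ≢ t) → g t ≡ 1ℤ) → ∏ g ≡ ∏ (g ∘ e)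
∏-image {zero} _ g off = ∏-one λ t → off t λ ()
∏-image {suc L} {zero} {e} _ _ _ with e zero
... | ()
∏-image {suc L} {suc n} {e} e-inj g off = begin
  ∏ g                                      ≡⟨ ∏-remove {i = e zero} g ⟩
  g (e zero) ℤ.* ∏ (g ∘ punchIn (e zero))  ≡⟨ cong (g (e zero) ℤ.*_) (∏-image e′-inj (g ∘ punchIn (e zero)) off′) ⟩
  g (e zero) ℤ.* ∏ (g ∘ punchIn (e zero) ∘ e′)
                                           ≡⟨ cong (g (e zero) ℤ.*_) (∏-cong λ i → cong g (Fin.punchIn-punchOut (e0≢ i))) ⟩
  ∏ (g ∘ e) ∎
  where
  open ≡-Reasoning
  e0≢ : ∀ i → e zero ≢ e (suc i)
  e0≢ i = Fin.0≢1+n ∘ e-inj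
  e′ : Fin L → Fin n
  e′ i = punchOut (e0≢ i)
  e′-inj : Inj e′
  e′-inj {x} {y} eq = Fin.suc-injective (e-inj (Fin.punchOut-injective (e0≢ x) (e0≢ y) eq))
  off′ : ∀ t → (∀ i → e′ i ≢ t) → g (punchIn (e zero) t) ≡ 1ℤ
  off′ t t∉e′ = off (punchIn (e zero) t) λ
    { zero eq → Fin.punchInᵢ≢i (e zero) t (sym eq)
    ; (suc i) eq → t∉e′ i (trans (Fin.punchOut-cong (e zero) eq) (Fin.punchOut-punchIn (e zero))) }

prodFin≡∏ : ∀ {k} (f : Fin k → ℤ) → prodFin f ≡ ∏ f
prodFin≡∏ f = go f id
  where
  go : ∀ {k m} (f : Fin m → ℤ) (g : Fin k → Fin m) → foldr ℤ._*_ 1ℤ (map f (tabulate g)) ≡ ∏ (f ∘ g)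
  go {zero} f g = refl
  go {suc k} f g = cong (f (g zero) ℤ.*_) (go f (g ∘ suc))

∏-zero : ∀ {n} {f : Fin n → ℤ} i → f i ≡ 0ℤ → ∏ f ≡ 0ℤ
∏-zero {suc n} {f} zero fi≡0 = cong (ℤ._* ∏ (f ∘ suc)) fi≡0
∏-zero {suc n} {f} (suc i) fi≡0 = trans (cong (f zero ℤ.*_) (∏-zero i fi≡0)) (ℤ.*-zeroʳ (f zero))

-- Sign times weight of a supported permutation

next-toℕ : ∀ {m} (i : Fin (suc m)) → (toℕ i ≡ m × next i ≡ zero) ⊎ toℕ (next i) ≡ suc (toℕ i)
next-toℕ {zero} zero = inj₁ (refl , refl)
next-toℕ {suc m} zero = inj₂ refl
next-toℕ {suc m} (suc i) with next i | next-toℕ i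
... | zero | inj₁ (i≡m , _) = inj₁ (cong suc i≡m , refl)
... | suc j | inj₂ eq = inj₂ (cong suc eq)

next-surjective : ∀ {m} (i : Fin (suc m)) → ∃ λ j → next j ≡ i
next-surjective {zero} zero = zero , refl
next-surjective {suc m} zero = fromℕ (suc m) , next-last (suc m)
  where
  next-last : ∀ m → next (fromℕ m) ≡ zero
  next-last zero = refl
  next-last (suc m) = next-suc-zero (next-last m)
next-surjective {suc m} (suc zero) = zero , refl
next-surjective {suc m} (suc (suc k)) with next-surjective {m} (suc k)
... | j , eq = suc j , next-suc-suc eq

next-≢ : ∀ {m} (i : Fin (suc (suc m))) → next i ≢ i
next-≢ zero ()
next-≢ {zero} (suc zero) ()
next-≢ {suc m} (suc i) with next i in eq
... | zero = λ ()
... | suc j = λ eq′ → next-≢ i (trans eq (Fin.suc-injective eq′))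

minimal-witness : ∀ {P : ℕ → Set} → Decidable P → ∀ {N} → P N → ∃ λ L → P L × (∀ {k} → k < L → ¬ P k)
minimal-witness {P} P? {N} = <-rec (λ N → P N → Minimal) step N
  where
  Minimal : Set
  Minimal = ∃ λ L → P L × (∀ {k} → k < L → ¬ P k)
  step : ∀ N → (∀ {k} → k < N → P k → Minimal) → P N → Minimal
  step N rec pN with ℕ.anyUpTo? P? N
  ... | yes (k , k<N , pk) = rec k<N pk
  ... | no none = N , pN , λ k<N pk → none (_ , k<N , pk)

module _ {n} {π : Fin n → Fin n} (π-inj : Inj π) where

  fold-cancel : ∀ a {x y} → fold x π a ≡ fold y π a → x ≡ y
  fold-cancel zero eq = eq
  fold-cancel (suc a) eq = fold-cancel a (π-inj eq)

  return-of-repeat : ∀ {v} a d → fold v π a ≡ fold v π (d + a) → fold v π d ≡ v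
  return-of-repeat {v} a d eq = sym (fold-cancel a (trans eq (trans (cong (fold v π) (ℕ.+-comm d a)) (fold-+ v π a))))

  minimal-period : ∀ v → ∃ λ p → fold v π (suc p) ≡ v × (∀ {k} → k < p → fold v π (suc k) ≢ v)
  minimal-period v with Fin.pigeonhole (ℕ.n<1+n n) (λ (i : Fin (suc n)) → fold v π (toℕ i))
  ... | i , j , i<j , eq = minimal-witness (λ k → fold v π (suc k) Fin.≟ v) {d} returns
    where
    d : ℕ
    d = toℕ j ∸ suc (toℕ i)
    returns : fold v π (suc d) ≡ v
    returns = return-of-repeat (toℕ i) (suc d) (trans eq (cong (fold v π) (sym (trans (sym (ℕ.+-suc d (toℕ i))) (ℕ.m∸n+n≡m i<j)))))

sum-≤ : ∀ {n} {f g : Fin n → ℕ} → (∀ i → f i ≤ g i) → sum f ≤ sum g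
sum-≤ {zero} f≤g = z≤n
sum-≤ {suc n} f≤g = ℕ.+-mono-≤ (f≤g zero) (sum-≤ (f≤g ∘ suc))

sum-< : ∀ {n} {f g : Fin n → ℕ} → (∀ i → f i ≤ g i) → ∀ i → f i < g i → sum f < sum g
sum-< f≤g zero lt = ℕ.+-mono-<-≤ lt (sum-≤ (f≤g ∘ suc))
sum-< f≤g (suc i) lt = ℕ.+-mono-≤-< (f≤g zero) (sum-< (f≤g ∘ suc) i lt)

isMoved : ∀ {n} → (Fin n → Fin n) → Fin n → ℕ
isMoved π t = 𝟙 (¬? (π t Fin.≟ t))

moved : ∀ {n} → (Fin n → Fin n) → ℕ
moved π = sum (isMoved π)

isMoved-fixed : ∀ {n} {π : Fin n → Fin n} {t} → π t ≡ t → isMoved π t ≡ 0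
isMoved-fixed {π = π} {t} πt≡t = 𝟙-no (λ πt≢t → πt≢t πt≡t) (¬? (π t Fin.≟ t))

isMoved-moved : ∀ {n} {π : Fin n → Fin n} {t} → π t ≢ t → isMoved π t ≡ 1
isMoved-moved {π = π} {t} πt≢t = 𝟙-yes πt≢t (¬? (π t Fin.≟ t))

module _ {n} (S : SignedDigraph n) where

  -- The (t , u) entry of zI − A(S), with the z on the diagonal read as 1.
  entryWeight : Fin n → Fin n → ℤ
  entryWeight t u with u Fin.≟ t
  ... | yes _ = 1ℤ
  ... | no _ = - adj S t u

  entryWeight-diag : ∀ t → entryWeight t t ≡ 1ℤ
  entryWeight-diag t with t Fin.≟ t
  ... | yes _ = refl
  ... | no t≢t = ⊥-elim (t≢t refl)

  entryWeight-off : ∀ {t u} → u ≢ t → entryWeight t u ≡ - adj S t u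
  entryWeight-off {t} {u} u≢t with u Fin.≟ t
  ... | yes u≡t = ⊥-elim (u≢t u≡t)
  ... | no _ = refl

  weight : (Fin n → Fin n) → ℤ
  weight π = ∏ λ t → entryWeight t (π t)

  Supported : (Fin n → Fin n) → Set
  Supported π = ∀ t → π t ≢ t → Arc S t (π t)

  -- π = cyclic e ∘ rest, where e runs through the cycle of π through v (of length M + 2) and rest fixes it.
  module CycleThrough (neg : AllCyclesNegative S) {π : Fin n → Fin n} (π-inj : Inj π) (π-supp : Supported π)
                      {v} (v-moved : π v ≢ v) {M} (returns : fold v π (suc (suc M)) ≡ v)
                      (minimal : ∀ {k} → k < suc M → fold v π (suc k) ≢ v) where

    e : Fin (suc (suc M)) → Fin n
    e i = fold v π (toℕ i)

    distinct-below : ∀ {a b} → a < b → b ≤ suc M → fold v π a ≢ fold v π b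
    distinct-below {a} {b} a<b b≤1+M eq = minimal d<1+M (return-of-repeat π-inj a (suc d) (trans eq (cong (fold v π) (sym b≡))))
      where
      d : ℕ
      d = b ∸ suc a
      b≡ : suc d + a ≡ b
      b≡ = trans (sym (ℕ.+-suc d a)) (ℕ.m∸n+n≡m a<b)
      d<1+M : d < suc M
      d<1+M = ℕ.≤-trans (ℕ.m≤m+n (suc d) a) (subst (_≤ suc M) (sym b≡) b≤1+M)

    e-inj : Inj e
    e-inj {i} {j} eq with ℕ.<-cmp (toℕ i) (toℕ j)
    ... | tri< i<j _ _ = ⊥-elim (distinct-below i<j (Fin.toℕ≤pred[n] j) eq)
    ... | tri≈ _ i≡j _ = Fin.toℕ-injective i≡j
    ... | tri> _ _ j<i = ⊥-elim (distinct-below j<i (Fin.toℕ≤pred[n] i) (sym eq))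

    e-next : ∀ i → e (next i) ≡ π (e i)
    e-next i with next-toℕ i
    ... | inj₁ (i≡1+M , next≡0) = trans (cong e next≡0) (sym (trans (cong (λ k → fold v π (suc k)) i≡1+M) returns))
    ... | inj₂ eq = cong (fold v π) eq

    e-moved : ∀ i → π (e i) ≢ e i
    e-moved i eq = next-≢ i (e-inj (trans (e-next i) eq))

    cycle : DirectedCycle S
    cycle = record
      { len-2 = M ; vertex = e ; distinct = λ i j → e-inj
      ; arcs = λ i → subst (Arc S (e i)) (sym (e-next i)) (π-supp (e i) (e-moved i)) }

    OnCycle : Fin n → Set
    OnCycle t = ∃ λ i → e i ≡ t

    onCycle? : ∀ t → Dec (OnCycle t)
    onCycle? t = Fin.any? (λ i → e i Fin.≟ t)

    off-cycle-closed : ∀ {t} → ¬ OnCycle t → ¬ OnCycle (π t)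
    off-cycle-closed {t} t∉ (i , ei≡πt) with next-surjective i
    ... | j , refl = t∉ (j , π-inj (trans (sym (e-next j)) ei≡πt))

    rest : Fin n → Fin n
    rest t with onCycle? t
    ... | yes _ = t
    ... | no _ = π t

    rest-on : ∀ {t} → OnCycle t → rest t ≡ t
    rest-on {t} t∈ with onCycle? t
    ... | yes _ = refl
    ... | no t∉ = ⊥-elim (t∉ t∈)

    rest-off : ∀ {t} → ¬ OnCycle t → rest t ≡ π t
    rest-off {t} t∉ with onCycle? t
    ... | yes t∈ = ⊥-elim (t∉ t∈)
    ... | no _ = refl

    π≗cyclic∘rest : ∀ t → π t ≡ cyclic e (rest t)
    π≗cyclic∘rest t with onCycle? t
    ... | yes (i , refl) = sym (trans (cyclic-on e-inj i) (e-next i))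
    ... | no t∉ = sym (cyclic-off λ i ei≡πt → off-cycle-closed t∉ (i , ei≡πt))

    rest-inj : Inj rest
    rest-inj {x} {y} eq = by-cases (onCycle? x) (onCycle? y)
      where
      by-cases : Dec (OnCycle x) → Dec (OnCycle y) → x ≡ y
      by-cases (yes x∈) (yes y∈) = trans (sym (rest-on x∈)) (trans eq (rest-on y∈))
      by-cases (yes (i , ei≡x)) (no y∉) = ⊥-elim (off-cycle-closed y∉ (i , trans ei≡x (trans (sym (rest-on (i , ei≡x))) (trans eq (rest-off y∉)))))
      by-cases (no x∉) (yes (i , ei≡y)) = ⊥-elim (off-cycle-closed x∉ (i , trans ei≡y (trans (sym (rest-on (i , ei≡y))) (trans (sym eq) (rest-off x∉)))))
      by-cases (no x∉) (no y∉) = π-inj (trans (sym (rest-off x∉)) (trans eq (rest-off y∉)))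

    rest-supported : Supported rest
    rest-supported t rest-moves with onCycle? t
    ... | yes _ = ⊥-elim (rest-moves refl)
    ... | no _ = π-supp t rest-moves

    moved-rest<moved : moved rest < moved π
    moved-rest<moved = sum-< isMoved-≤ v (subst₂ _<_ (sym (isMoved-fixed {π = rest} (rest-on (zero , refl)))) (sym (isMoved-moved {π = π} v-moved)) ℕ.0<1+n)
      where
      isMoved-≤ : ∀ t → isMoved rest t ≤ isMoved π t
      isMoved-≤ t = by-cases (onCycle? t)
        where
        by-cases : Dec (OnCycle t) → isMoved rest t ≤ isMoved π t
        by-cases (yes t∈) = ℕ.≤-trans (ℕ.≤-reflexive (isMoved-fixed {π = rest} (rest-on t∈))) z≤n
        by-cases (no t∉) = ℕ.≤-reflexive (cong (λ u → 𝟙 (¬? (u Fin.≟ t))) (rest-off t∉))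

    cycleFactor : Fin n → ℤ
    cycleFactor t with onCycle? t
    ... | yes _ = entryWeight t (π t)
    ... | no _ = 1ℤ

    entryWeight-split : ∀ t → entryWeight t (π t) ≡ entryWeight t (rest t) ℤ.* cycleFactor t
    entryWeight-split t with onCycle? t
    ... | yes _ = sym (trans (cong (ℤ._* entryWeight t (π t)) (entryWeight-diag t)) (ℤ.*-identityˡ _))
    ... | no _ = sym (ℤ.*-identityʳ _)

    ∏-cycleFactor : ∏ cycleFactor ≡ -1ℤ ℤ.^ suc (suc M) ℤ.* -1ℤ
    ∏-cycleFactor = begin
      ∏ cycleFactor                                          ≡⟨ ∏-image e-inj cycleFactor off-cycle ⟩
      ∏ (cycleFactor ∘ e)                                    ≡⟨ ∏-cong on-cycle ⟩
      ∏ (λ i → - adj S (e i) (e (next i)))                   ≡⟨ ∏-neg (λ i → adj S (e i) (e (next i))) ⟩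
      -1ℤ ℤ.^ suc (suc M) ℤ.* ∏ (λ i → adj S (e i) (e (next i)))
        ≡⟨ cong (-1ℤ ℤ.^ suc (suc M) ℤ.*_) (trans (sym (prodFin≡∏ (λ i → adj S (e i) (e (next i))))) (neg cycle)) ⟩
      -1ℤ ℤ.^ suc (suc M) ℤ.* -1ℤ ∎
      where
      open ≡-Reasoning
      off-cycle : ∀ t → (∀ i → e i ≢ t) → cycleFactor t ≡ 1ℤ
      off-cycle t t∉ with onCycle? t
      ... | yes (i , ei≡t) = ⊥-elim (t∉ i ei≡t)
      ... | no _ = refl
      on-cycle : ∀ i → cycleFactor (e i) ≡ - adj S (e i) (e (next i))
      on-cycle i with onCycle? (e i)
      ... | yes _ = trans (entryWeight-off (e-moved i)) (cong (λ u → - adj S (e i) u) (sym (e-next i)))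
      ... | no ∉ = ⊥-elim (∉ (i , refl))

    -- The cycle contributes (−1)^(M+1) to the sign and (−1)^(M+2) · cycleSign = (−1)^(M+3) to the weight.
    sgn-weight-rest : sgn π ℤ.* weight π ≡ sgn rest ℤ.* weight rest
    sgn-weight-rest = begin
      sgn π ℤ.* weight π
        ≡⟨ cong₂ ℤ._*_ (trans (sgn-cong π≗cyclic∘rest) (sgn-∘ (proj₁ cyclic-facts) rest-inj))
                       (trans (∏-cong entryWeight-split) (∏-distrib-* (λ t → entryWeight t (rest t)) cycleFactor)) ⟩
      (sgn (cyclic e) ℤ.* sgn rest) ℤ.* (weight rest ℤ.* ∏ cycleFactor)
        ≡⟨ cong₂ (λ a b → (a ℤ.* sgn rest) ℤ.* (weight rest ℤ.* b)) (proj₂ cyclic-facts) ∏-cycleFactor ⟩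
      (s ℤ.* sgn rest) ℤ.* (weight rest ℤ.* ((-1ℤ ℤ.* s) ℤ.* -1ℤ))
        ≡⟨ rearrange s (sgn rest) (weight rest) ⟩
      (sgn rest ℤ.* weight rest) ℤ.* (s ℤ.* s)
        ≡⟨ cong ((sgn rest ℤ.* weight rest) ℤ.*_) (trans (sym (ℤ.^-distribˡ-+-* -1ℤ (suc M) (suc M))) (-1^-double (suc M))) ⟩
      (sgn rest ℤ.* weight rest) ℤ.* 1ℤ
        ≡⟨ ℤ.*-identityʳ _ ⟩
      sgn rest ℤ.* weight rest ∎
      where
      open ≡-Reasoning
      s : ℤ
      s = -1ℤ ℤ.^ suc M
      cyclic-facts : Inj (cyclic e) × sgn (cyclic e) ≡ s
      cyclic-facts = cyclic-inj-sgn (suc M) e-inj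
      rearrange : ∀ a r w → (a ℤ.* r) ℤ.* (w ℤ.* ((-1ℤ ℤ.* a) ℤ.* -1ℤ)) ≡ (r ℤ.* w) ℤ.* (a ℤ.* a)
      rearrange = solve-∀

  sgn-weight : AllCyclesNegative S → ∀ π → Inj π → Supported π → sgn π ℤ.* weight π ≡ 1ℤ
  sgn-weight neg = All.wfRec (On.wellFounded moved <-wellFounded) 0ℓ _ step
    where
    step : ∀ π → (∀ {ρ} → moved ρ < moved π → Inj ρ → Supported ρ → sgn ρ ℤ.* weight ρ ≡ 1ℤ) →
           Inj π → Supported π → sgn π ℤ.* weight π ≡ 1ℤ
    step π ih π-inj π-supp with Fin.any? (λ t → ¬? (π t Fin.≟ t))
    ... | no none = cong₂ ℤ._*_ (sgn-id fixed) (∏-one λ t → trans (cong (entryWeight t) (fixed t)) (entryWeight-diag t))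
      where
      fixed : ∀ t → π t ≡ t
      fixed t = decidable-stable (π t Fin.≟ t) (λ πt≢t → none (t , πt≢t))
    ... | yes (v , v-moved) with minimal-period π-inj v
    ...   | zero , returns , _ = ⊥-elim (v-moved returns)
    ...   | suc M , returns , minimal = trans C.sgn-weight-rest (ih C.moved-rest<moved C.rest-inj C.rest-supported)
      where module C = CycleThrough neg π-inj π-supp v-moved returns minimal

-- The Leibniz expansion of det

coeff-+P : ∀ p q k → coeff (p +P q) k ≡ coeff p k ℤ.+ coeff q k
coeff-+P [] q k = sym (ℤ.+-identityˡ (coeff q k))
coeff-+P (a ∷ p) [] k = sym (ℤ.+-identityʳ (coeff (a ∷ p) k))
coeff-+P (a ∷ p) (b ∷ q) zero = refl
coeff-+P (a ∷ p) (b ∷ q) (suc k) = coeff-+P p q k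

coeff-scaleP : ∀ a p k → coeff (scaleP a p) k ≡ a ℤ.* coeff p k
coeff-scaleP a [] k = sym (ℤ.*-zeroʳ a)
coeff-scaleP a (x ∷ p) zero = refl
coeff-scaleP a (x ∷ p) (suc k) = coeff-scaleP a p k

convolve : Poly → (ℕ → ℤ) → ℕ → ℤ
convolve [] f k = 0ℤ
convolve (a ∷ p) f zero = a ℤ.* f zero ℤ.+ 0ℤ
convolve (a ∷ p) f (suc k) = a ℤ.* f (suc k) ℤ.+ convolve p f k

coeff-*P : ∀ p q k → coeff (p *P q) k ≡ convolve p (coeff q) k
coeff-*P [] q k = refl
coeff-*P (a ∷ p) q zero = trans (coeff-+P (scaleP a q) (ℤ.+ 0 ∷ (p *P q)) zero) (cong (ℤ._+ 0ℤ) (coeff-scaleP a q zero))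
coeff-*P (a ∷ p) q (suc k) = trans (coeff-+P (scaleP a q) (ℤ.+ 0 ∷ (p *P q)) (suc k)) (cong₂ ℤ._+_ (coeff-scaleP a q (suc k)) (coeff-*P p q k))

convolve-cong : ∀ p {f g : ℕ → ℤ} → (∀ k → f k ≡ g k) → ∀ k → convolve p f k ≡ convolve p g k
convolve-cong [] f≗g k = refl
convolve-cong (a ∷ p) f≗g zero = cong (λ x → a ℤ.* x ℤ.+ 0ℤ) (f≗g zero)
convolve-cong (a ∷ p) f≗g (suc k) = cong₂ (λ x y → a ℤ.* x ℤ.+ y) (f≗g (suc k)) (convolve-cong p f≗g k)

convolve-* : ∀ p a (f : ℕ → ℤ) k → convolve p (λ k′ → a ℤ.* f k′) k ≡ a ℤ.* convolve p f k
convolve-* [] a f k = sym (ℤ.*-zeroʳ a)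
convolve-* (x ∷ p) a f zero = swap x a (f zero)
  where
  swap : ∀ x a y → x ℤ.* (a ℤ.* y) ℤ.+ 0ℤ ≡ a ℤ.* (x ℤ.* y ℤ.+ 0ℤ)
  swap = solve-∀
convolve-* (x ∷ p) a f (suc k) = trans (cong₂ ℤ._+_ (ℤ*.x∙yz≈y∙xz x a (f (suc k))) (convolve-* p a f k)) (sym (ℤ.*-distribˡ-+ a _ _))

Code : ℕ → Set
Code zero = ⊤
Code (suc n) = Fin (suc n) × Code n

perm : ∀ {n} → Code n → Fin n → Fin n
perm {suc n} (j , c) zero = j
perm {suc n} (j , c) (suc i) = punchIn j (perm c i)

perm-inj : ∀ {n} (c : Code n) → Inj (perm c)
perm-inj {suc n} (j , c) {zero} {zero} eq = refl
perm-inj {suc n} (j , c) {zero} {suc y} eq = ⊥-elim (Fin.punchInᵢ≢i j (perm c y) (sym eq))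
perm-inj {suc n} (j , c) {suc x} {zero} eq = ⊥-elim (Fin.punchInᵢ≢i j (perm c x) eq)
perm-inj {suc n} (j , c) {suc x} {suc y} eq = cong suc (perm-inj c (Fin.punchIn-injective j _ _ eq))

sgnCode : ∀ {n} → Code n → ℤ
sgnCode {zero} c = 1ℤ
sgnCode {suc n} (j , c) = -1ℤ ℤ.^ toℕ j ℤ.* sgnCode c

module CodeSum {a ℓ} (R : Semiring a ℓ) where

  open Semiring R using (Carrier; _≈_; 0#) renaming (refl to ≈-refl; trans to ≈-trans)
  private module R = Semiring R
  private module Σ = SemiringSum R

  ∑Code : ∀ {n} → (Code n → Carrier) → Carrier
  ∑Code {zero} F = F tt
  ∑Code {suc n} F = Σ.sum λ j → ∑Code λ c → F (j , c)

  ∑Code-cong : ∀ {n} {F G : Code n → Carrier} → (∀ c → F c ≈ G c) → ∑Code F ≈ ∑Code G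
  ∑Code-cong {zero} F≈G = F≈G tt
  ∑Code-cong {suc n} F≈G = Σ.sum-cong-≋ λ j → ∑Code-cong λ c → F≈G (j , c)

  ∑Code-distrib-+ : ∀ {n} (F G : Code n → Carrier) → ∑Code (λ c → F c R.+ G c) ≈ ∑Code F R.+ ∑Code G
  ∑Code-distrib-+ {zero} F G = ≈-refl
  ∑Code-distrib-+ {suc n} F G =
    ≈-trans (Σ.sum-cong-≋ λ j → ∑Code-distrib-+ (λ c → F (j , c)) (λ c → G (j , c)))
            (Σ.∑-distrib-+ (λ j → ∑Code λ c → F (j , c)) (λ j → ∑Code λ c → G (j , c)))

  *-distribˡ-∑Code : ∀ {n} x (F : Code n → Carrier) → x R.* ∑Code F ≈ ∑Code (λ c → x R.* F c)
  *-distribˡ-∑Code {zero} x F = ≈-refl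
  *-distribˡ-∑Code {suc n} x F =
    ≈-trans (Σ.*-distribˡ-sum x λ j → ∑Code λ c → F (j , c)) (Σ.sum-cong-≋ λ j → *-distribˡ-∑Code x λ c → F (j , c))

  ∑Code-zero : ∀ {n} {F : Code n → Carrier} → (∀ c → F c ≈ 0#) → ∑Code F ≈ 0#
  ∑Code-zero {zero} F≈0 = F≈0 tt
  ∑Code-zero {suc n} F≈0 = ≈-trans (Σ.sum-cong-≋ λ j → ∑Code-zero λ c → F≈0 (j , c)) (Σ.sum-replicate-zero (suc n))

module ℤCode = CodeSum ℤ.+-*-semiring
module ℕCode = CodeSum ℕ.+-*-semiring

convolve-∑Code : ∀ {n} p (F : Code n → ℕ → ℤ) k →
  convolve p (λ k′ → ℤCode.∑Code λ c → F c k′) k ≡ ℤCode.∑Code (λ c → convolve p (F c) k)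
convolve-∑Code {n} [] F k = sym (ℤCode.∑Code-zero {n} {λ _ → 0ℤ} λ _ → refl)
convolve-∑Code (a ∷ p) F zero = begin
  a ℤ.* ℤCode.∑Code (λ c → F c zero) ℤ.+ 0ℤ      ≡⟨ ℤ.+-identityʳ _ ⟩
  a ℤ.* ℤCode.∑Code (λ c → F c zero)              ≡⟨ ℤCode.*-distribˡ-∑Code a (λ c → F c zero) ⟩
  ℤCode.∑Code (λ c → a ℤ.* F c zero)              ≡⟨ ℤCode.∑Code-cong (λ c → ℤ.+-identityʳ (a ℤ.* F c zero)) ⟨
  ℤCode.∑Code (λ c → a ℤ.* F c zero ℤ.+ 0ℤ) ∎
  where open ≡-Reasoning
convolve-∑Code (a ∷ p) F (suc k) = begin
  a ℤ.* ℤCode.∑Code (λ c → F c (suc k)) ℤ.+ convolve p (λ k′ → ℤCode.∑Code λ c → F c k′) k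
    ≡⟨ cong₂ ℤ._+_ (ℤCode.*-distribˡ-∑Code a (λ c → F c (suc k))) (convolve-∑Code p F k) ⟩
  ℤCode.∑Code (λ c → a ℤ.* F c (suc k)) ℤ.+ ℤCode.∑Code (λ c → convolve p (F c) k)
    ≡⟨ ℤCode.∑Code-distrib-+ (λ c → a ℤ.* F c (suc k)) (λ c → convolve p (F c) k) ⟨
  ℤCode.∑Code (λ c → a ℤ.* F c (suc k) ℤ.+ convolve p (F c) k) ∎
  where open ≡-Reasoning

∏P : ∀ {n} → (Fin n → Poly) → Poly
∏P {zero} f = ℤ.+ 1 ∷ []
∏P {suc n} f = f zero *P ∏P (f ∘ suc)

coeff-∑P : ∀ {m n} (h : Fin n → Poly) (g : Fin m → Fin n) k →
  coeff (foldr _+P_ [] (map h (tabulate g))) k ≡ ∑ (λ i → coeff (h (g i)) k)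
coeff-∑P {zero} h g k = refl
coeff-∑P {suc m} h g k = trans (coeff-+P (h (g zero)) (foldr _+P_ [] (map h (tabulate (g ∘ suc)))) k)
  (cong (λ x → coeff (h (g zero)) k ℤ.+ x) (coeff-∑P h (g ∘ suc) k))

coeff-det : ∀ n (M : Fin n → Fin n → Poly) k →
  coeff (det n M) k ≡ ℤCode.∑Code (λ c → sgnCode c ℤ.* coeff (∏P (λ t → M t (perm c t))) k)
coeff-det zero M k = sym (ℤ.*-identityˡ _)
coeff-det (suc n) M k = trans (coeff-∑P minorTerm id k) (∑-cong expand)
  where
  minor : Fin (suc n) → Fin n → Fin n → Poly
  minor j i l = M (suc i) (punchIn j l)
  minorTerm : Fin (suc n) → Poly
  minorTerm j = scaleP (-1ℤ ℤ.^ toℕ j) (M zero j *P det n (minor j))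
  expand : ∀ j → coeff (minorTerm j) k
               ≡ ℤCode.∑Code (λ c → (-1ℤ ℤ.^ toℕ j ℤ.* sgnCode c) ℤ.* coeff (∏P (λ t → M t (perm {suc n} (j , c) t))) k)
  expand j = begin
    coeff (minorTerm j) k
      ≡⟨ coeff-scaleP (-1ℤ ℤ.^ toℕ j) (M zero j *P det n (minor j)) k ⟩
    -1ℤ ℤ.^ toℕ j ℤ.* coeff (M zero j *P det n (minor j)) k
      ≡⟨ cong (-1ℤ ℤ.^ toℕ j ℤ.*_) (coeff-*P (M zero j) (det n (minor j)) k) ⟩
    -1ℤ ℤ.^ toℕ j ℤ.* convolve (M zero j) (coeff (det n (minor j))) k
      ≡⟨ cong (-1ℤ ℤ.^ toℕ j ℤ.*_) (convolve-cong (M zero j) (coeff-det n (minor j)) k) ⟩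
    -1ℤ ℤ.^ toℕ j ℤ.* convolve (M zero j) (λ k′ → ℤCode.∑Code λ c → sgnCode c ℤ.* coeff (Q c) k′) k
      ≡⟨ cong (-1ℤ ℤ.^ toℕ j ℤ.*_) (convolve-∑Code (M zero j) (λ c k′ → sgnCode c ℤ.* coeff (Q c) k′) k) ⟩
    -1ℤ ℤ.^ toℕ j ℤ.* ℤCode.∑Code (λ c → convolve (M zero j) (λ k′ → sgnCode c ℤ.* coeff (Q c) k′) k)
      ≡⟨ ℤCode.*-distribˡ-∑Code (-1ℤ ℤ.^ toℕ j) (λ c → convolve (M zero j) (λ k′ → sgnCode c ℤ.* coeff (Q c) k′) k) ⟩
    ℤCode.∑Code (λ c → -1ℤ ℤ.^ toℕ j ℤ.* convolve (M zero j) (λ k′ → sgnCode c ℤ.* coeff (Q c) k′) k)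
      ≡⟨ ℤCode.∑Code-cong (λ c → begin
           -1ℤ ℤ.^ toℕ j ℤ.* convolve (M zero j) (λ k′ → sgnCode c ℤ.* coeff (Q c) k′) k
             ≡⟨ cong (-1ℤ ℤ.^ toℕ j ℤ.*_) (convolve-* (M zero j) (sgnCode c) (coeff (Q c)) k) ⟩
           -1ℤ ℤ.^ toℕ j ℤ.* (sgnCode c ℤ.* convolve (M zero j) (coeff (Q c)) k)
             ≡⟨ ℤ.*-assoc (-1ℤ ℤ.^ toℕ j) (sgnCode c) _ ⟨
           (-1ℤ ℤ.^ toℕ j ℤ.* sgnCode c) ℤ.* convolve (M zero j) (coeff (Q c)) k
             ≡⟨ cong ((-1ℤ ℤ.^ toℕ j ℤ.* sgnCode c) ℤ.*_) (coeff-*P (M zero j) (Q c) k) ⟨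
           (-1ℤ ℤ.^ toℕ j ℤ.* sgnCode c) ℤ.* coeff (M zero j *P Q c) k ∎) ⟩
    ℤCode.∑Code (λ c → (-1ℤ ℤ.^ toℕ j ℤ.* sgnCode c) ℤ.* coeff (∏P (λ t → M t (perm {suc n} (j , c) t))) k) ∎
    where
    open ≡-Reasoning
    Q : Code n → Poly
    Q c = ∏P (λ t → minor j t (perm c t))

punchIn-<-pivot : ∀ {n} (j : Fin (suc n)) (x : Fin n) →
  (toℕ (punchIn j x) < toℕ j → toℕ x < toℕ j) × (toℕ x < toℕ j → toℕ (punchIn j x) < toℕ j)
punchIn-<-pivot zero x = (λ ()) , (λ ())
punchIn-<-pivot (suc j) zero = (λ _ → s≤s z≤n) , (λ _ → s≤s z≤n)
punchIn-<-pivot (suc j) (suc x) = (s≤s ∘ proj₁ (punchIn-<-pivot j x) ∘ ℕ.≤-pred) , (s≤s ∘ proj₂ (punchIn-<-pivot j x) ∘ ℕ.≤-pred)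

punchIn-< : ∀ {n} (j : Fin (suc n)) {x y : Fin n} → (punchIn j x Fin.< punchIn j y → x Fin.< y) × (x Fin.< y → punchIn j x Fin.< punchIn j y)
punchIn-< j {x} {y} =
    (λ lt → ℕ.≰⇒> (ℕ.<⇒≱ lt ∘ Fin.punchIn-mono-≤ j y x))
  , (λ lt → ℕ.≰⇒> (ℕ.<⇒≱ lt ∘ Fin.punchIn-cancel-≤ j y x))

count-below : ∀ n J → J ≤ n → sum {n} (λ x → 𝟙 (toℕ x ℕ.<? J)) ≡ J
count-below n zero _ = sum-zero {n} _ λ _ → refl
count-below (suc n) (suc J) (s≤s J≤n) =
  cong suc (trans (sum-cong-≗ {n} λ x → 𝟙-cong ℕ.≤-pred s≤s (suc (toℕ x) ℕ.<? suc J) (toℕ x ℕ.<? J)) (count-below n J J≤n))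

inversions-perm : ∀ {n} (j : Fin (suc n)) (c : Code n) → inversions (perm {suc n} (j , c)) ≡ toℕ j + inversions (perm c)
inversions-perm {n} j c = cong₂ _+_ first-row other-rows
  where
  π : Fin (suc n) → Fin (suc n)
  π = perm (j , c)
  π′ : Fin n → Fin n
  π′ = perm c
  first-row : sum (λ y → [ zero < y ] * [ π y < π zero ]) ≡ toℕ j
  first-row = begin
    sum {n} (λ x → [ punchIn j (π′ x) < j ] + 0)
      ≡⟨ sum-cong-≗ (λ x → trans (ℕ.+-identityʳ _) (𝟙-cong (proj₁ (punchIn-<-pivot j (π′ x))) (proj₂ (punchIn-<-pivot j (π′ x)))
                                                         (punchIn j (π′ x) Fin.<? j) (toℕ (π′ x) ℕ.<? toℕ j))) ⟩
    sum (λ x → 𝟙 (toℕ (π′ x) ℕ.<? toℕ j))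
      ≡⟨ sum-reindex (λ x → 𝟙 (toℕ x ℕ.<? toℕ j)) π′ (perm-inj c) ⟨
    sum (λ (x : Fin n) → 𝟙 (toℕ x ℕ.<? toℕ j))
      ≡⟨ count-below n (toℕ j) (Fin.toℕ≤pred[n] j) ⟩
    toℕ j ∎
    where open ≡-Reasoning
  other-rows : sum (λ i → sum λ y → [ suc i < y ] * [ π y < π (suc i) ]) ≡ inversions π′
  other-rows = sum-cong-≗ λ i → sum-cong-≗ λ y → cong₂ _*_
    (𝟙-cong ℕ.≤-pred s≤s (suc i Fin.<? suc y) (i Fin.<? y))
    (𝟙-cong (proj₁ (punchIn-< j)) (proj₂ (punchIn-< j)) (π (suc y) Fin.<? π (suc i)) (π′ y Fin.<? π′ i))

sgnCode≡sgn : ∀ {n} (c : Code n) → sgnCode c ≡ sgn (perm c)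
sgnCode≡sgn {zero} tt = refl
sgnCode≡sgn {suc n} (j , c) = begin
  -1ℤ ℤ.^ toℕ j ℤ.* sgnCode c                 ≡⟨ cong (-1ℤ ℤ.^ toℕ j ℤ.*_) (sgnCode≡sgn c) ⟩
  -1ℤ ℤ.^ toℕ j ℤ.* -1ℤ ℤ.^ inversions (perm c) ≡⟨ ℤ.^-distribˡ-+-* -1ℤ (toℕ j) _ ⟨
  -1ℤ ℤ.^ (toℕ j + inversions (perm c))        ≡⟨ cong (-1ℤ ℤ.^_) (inversions-perm j c) ⟨
  sgn (perm (j , c)) ∎
  where open ≡-Reasoning

-- Coefficients of the characteristic polynomial as counts

-- The Kronecker delta, by recursion so that it follows the shifts of coefficient lists.
δ : ℕ → ℕ → ℤ
δ zero zero = 1ℤ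
δ zero (suc b) = 0ℤ
δ (suc a) zero = 0ℤ
δ (suc a) (suc b) = δ a b

δ≡𝟙 : ∀ a b → δ a b ≡ ℤ.+ 𝟙 (a ℕ.≟ b)
δ≡𝟙 zero zero = refl
δ≡𝟙 zero (suc b) = refl
δ≡𝟙 (suc a) zero = refl
δ≡𝟙 (suc a) (suc b) = trans (δ≡𝟙 a b) (cong ℤ.+_ (𝟙-cong (cong suc) ℕ.suc-injective (a ℕ.≟ b) (suc a ℕ.≟ suc b)))

linearPoly : Maybe ℤ → Poly
linearPoly nothing = ℤ.+ 0 ∷ ℤ.+ 1 ∷ []
linearPoly (just a) = a ∷ []

zDegree : Maybe ℤ → ℕ
zDegree nothing = 1
zDegree (just _) = 0

constant : Maybe ℤ → ℤ
constant nothing = 1ℤ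
constant (just a) = a

coeff-∏P-monomial : ∀ {n} (m : Fin n → Maybe ℤ) k →
  coeff (∏P (linearPoly ∘ m)) k ≡ δ (sum (zDegree ∘ m)) k ℤ.* ∏ (constant ∘ m)
coeff-∏P-monomial {zero} m zero = refl
coeff-∏P-monomial {zero} m (suc k) = refl
coeff-∏P-monomial {suc n} m k = begin
  coeff (linearPoly (m zero) *P ∏P (linearPoly ∘ m ∘ suc)) k
    ≡⟨ coeff-*P (linearPoly (m zero)) (∏P (linearPoly ∘ m ∘ suc)) k ⟩
  convolve (linearPoly (m zero)) (coeff (∏P (linearPoly ∘ m ∘ suc))) k
    ≡⟨ convolve-cong (linearPoly (m zero)) (coeff-∏P-monomial (m ∘ suc)) k ⟩
  convolve (linearPoly (m zero)) (λ k′ → δ s k′ ℤ.* P) k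
    ≡⟨ first-factor (m zero) k ⟩
  δ (zDegree (m zero) + s) k ℤ.* (constant (m zero) ℤ.* P) ∎
  where
  open ≡-Reasoning
  s : ℕ
  s = sum (zDegree ∘ m ∘ suc)
  P : ℤ
  P = ∏ (constant ∘ m ∘ suc)
  times-constant : ∀ x d p → x ℤ.* (d ℤ.* p) ℤ.+ 0ℤ ≡ d ℤ.* (x ℤ.* p)
  times-constant = solve-∀
  times-z : ∀ a d p → 0ℤ ℤ.* a ℤ.+ (1ℤ ℤ.* (d ℤ.* p) ℤ.+ 0ℤ) ≡ d ℤ.* (1ℤ ℤ.* p)
  times-z = solve-∀
  first-factor : ∀ x k → convolve (linearPoly x) (λ k′ → δ s k′ ℤ.* P) k ≡ δ (zDegree x + s) k ℤ.* (constant x ℤ.* P)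
  first-factor (just x) zero = times-constant x (δ s zero) P
  first-factor (just x) (suc k) = times-constant x (δ s (suc k)) P
  first-factor nothing zero = refl
  first-factor nothing (suc zero) = times-z (δ s 1 ℤ.* P) (δ s zero) P
  first-factor nothing (suc (suc k)) = times-z (δ s (suc (suc k)) ℤ.* P) (δ s (suc k)) P

∏P-cong : ∀ {n} {f g : Fin n → Poly} → (∀ i → f i ≡ g i) → ∏P f ≡ ∏P g
∏P-cong {zero} f≗g = refl
∏P-cong {suc n} f≗g = cong₂ _*P_ (f≗g zero) (∏P-cong (f≗g ∘ suc))

entry-nothing : ∀ {m : Maybe Sign} → ¬ Is-just m → entry m ≡ 0ℤ
entry-nothing {just s} no-arc = ⊥-elim (no-arc (just tt))
entry-nothing {nothing} _ = refl

fixedPoints : ∀ {n} → (Fin n → Fin n) → ℕ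
fixedPoints π = sum λ t → 𝟙 (π t Fin.≟ t)

∑-pos : ∀ {n} (f : Fin n → ℕ) → ∑ (λ i → ℤ.+ f i) ≡ ℤ.+ sum f
∑-pos {zero} f = refl
∑-pos {suc n} f = trans (cong (λ x → ℤ.+ f zero ℤ.+ x) (∑-pos (f ∘ suc))) (sym (ℤ.pos-+ (f zero) (sum (f ∘ suc))))

∑Code-pos : ∀ {n} (F : Code n → ℕ) → ℤCode.∑Code (λ c → ℤ.+ F c) ≡ ℤ.+ ℕCode.∑Code F
∑Code-pos {zero} F = refl
∑Code-pos {suc n} F = trans (∑-cong λ j → ∑Code-pos λ c → F (j , c)) (∑-pos λ j → ℕCode.∑Code λ c → F (j , c))

module _ {n} (S : SignedDigraph n) where

  entryShape : (Fin n → Fin n) → Fin n → Maybe ℤ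
  entryShape π t with π t Fin.≟ t
  ... | yes _ = nothing
  ... | no _ = just (- adj S t (π t))

  zI-A≡linearPoly : ∀ π t → zI-A S t (π t) ≡ linearPoly (entryShape π t)
  zI-A≡linearPoly π t with π t Fin.≟ t
  ... | yes πt≡t rewrite πt≡t | dec-true (t Fin.≟ t) refl | loopless S t = refl
  ... | no πt≢t rewrite dec-false (t Fin.≟ π t) (πt≢t ∘ sym) = refl

  zDegree-entryShape : ∀ π t → zDegree (entryShape π t) ≡ 𝟙 (π t Fin.≟ t)
  zDegree-entryShape π t with π t Fin.≟ t
  ... | yes _ = refl
  ... | no _ = refl

  constant-entryShape : ∀ π t → constant (entryShape π t) ≡ entryWeight S t (π t)
  constant-entryShape π t with π t Fin.≟ t
  ... | yes _ = refl
  ... | no _ = refl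

  coeff-charPoly : ∀ k → coeff (charPoly S) k ≡ ℤCode.∑Code λ c → sgnCode c ℤ.* (δ (fixedPoints (perm c)) k ℤ.* weight S (perm c))
  coeff-charPoly k = trans (coeff-det n (zI-A S) k) (ℤCode.∑Code-cong λ c → cong (sgnCode c ℤ.*_) (begin
    coeff (∏P (λ t → zI-A S t (perm c t))) k
      ≡⟨ cong (λ p → coeff p k) (∏P-cong (zI-A≡linearPoly (perm c))) ⟩
    coeff (∏P (linearPoly ∘ entryShape (perm c))) k
      ≡⟨ coeff-∏P-monomial (entryShape (perm c)) k ⟩
    δ (sum (zDegree ∘ entryShape (perm c))) k ℤ.* ∏ (constant ∘ entryShape (perm c))
      ≡⟨ cong₂ (λ d w → δ d k ℤ.* w) (sum-cong-≗ (zDegree-entryShape (perm c))) (∏-cong (constant-entryShape (perm c))) ⟩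
    δ (fixedPoints (perm c)) k ℤ.* weight S (perm c) ∎))
    where open ≡-Reasoning

  supported? : ∀ π → Dec (Supported S π)
  supported? π = Fin.all? λ t → ¬? (π t Fin.≟ t) →-dec isJust? (arc S t (π t))

  CountedWith : ℕ → Code n → Set
  CountedWith k c = fixedPoints (perm c) ≡ k × Supported S (perm c)

  countedWith? : ∀ k c → Dec (CountedWith k c)
  countedWith? k c = (fixedPoints (perm c) ℕ.≟ k) ×-dec supported? (perm c)

  leibnizTerm≡𝟙 : AllCyclesNegative S → ∀ k c →
    sgnCode c ℤ.* (δ (fixedPoints (perm c)) k ℤ.* weight S (perm c)) ≡ ℤ.+ 𝟙 (countedWith? k c)
  leibnizTerm≡𝟙 neg k c with supported? (perm c)
  ... | yes supp = begin
    sgnCode c ℤ.* (δ (fixedPoints π) k ℤ.* weight S π)   ≡⟨ ℤ*.x∙yz≈y∙xz (sgnCode c) (δ (fixedPoints π) k) (weight S π) ⟩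
    δ (fixedPoints π) k ℤ.* (sgnCode c ℤ.* weight S π)   ≡⟨ cong (λ s → δ (fixedPoints π) k ℤ.* (s ℤ.* weight S π)) (sgnCode≡sgn c) ⟩
    δ (fixedPoints π) k ℤ.* (sgn π ℤ.* weight S π)       ≡⟨ cong (δ (fixedPoints π) k ℤ.*_) (sgn-weight S neg π (perm-inj c) supp) ⟩
    δ (fixedPoints π) k ℤ.* 1ℤ                            ≡⟨ ℤ.*-identityʳ _ ⟩
    δ (fixedPoints π) k                                   ≡⟨ δ≡𝟙 (fixedPoints π) k ⟩
    ℤ.+ 𝟙 (fixedPoints π ℕ.≟ k)
      ≡⟨ cong ℤ.+_ (𝟙-cong (_, supp) proj₁ (fixedPoints π ℕ.≟ k) (fixedPoints π ℕ.≟ k ×-dec yes supp)) ⟩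
    ℤ.+ 𝟙 (fixedPoints π ℕ.≟ k ×-dec yes supp) ∎
    where
    open ≡-Reasoning
    π : Fin n → Fin n
    π = perm c
  ... | no unsupp = trans (cong (λ w → sgnCode c ℤ.* (δ (fixedPoints π) k ℤ.* w)) weight≡0)
                   (trans (cong (sgnCode c ℤ.*_) (ℤ.*-zeroʳ (δ (fixedPoints π) k)))
                   (trans (ℤ.*-zeroʳ (sgnCode c)) (sym (cong ℤ.+_ (𝟙-no (unsupp ∘ proj₂) (fixedPoints π ℕ.≟ k ×-dec no unsupp))))))
    where
    π : Fin n → Fin n
    π = perm c
    witness : ∃ λ t → ¬ (π t ≢ t → Arc S t (π t))
    witness = Fin.¬∀⟶∃¬ n _ (λ t → ¬? (π t Fin.≟ t) →-dec isJust? (arc S t (π t))) unsupp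
    t : Fin n
    t = proj₁ witness
    moved-t : π t ≢ t
    moved-t πt≡t = proj₂ witness λ πt≢t → ⊥-elim (πt≢t πt≡t)
    no-arc : ¬ Arc S t (π t)
    no-arc a = proj₂ witness λ _ → a
    weight≡0 : weight S π ≡ 0ℤ
    weight≡0 = ∏-zero t (trans (entryWeight-off S moved-t) (cong -_ (entry-nothing no-arc)))

  coeff-charPoly≡count : AllCyclesNegative S → ∀ k → coeff (charPoly S) k ≡ ℤ.+ ℕCode.∑Code (λ c → 𝟙 (countedWith? k c))
  coeff-charPoly≡count neg k =
    trans (coeff-charPoly k) (trans (ℤCode.∑Code-cong (leibnizTerm≡𝟙 neg k)) (∑Code-pos λ c → 𝟙 (countedWith? k c)))

-- Counting codes and linear subdigraphs

sum-𝟙-≟ : ∀ {n} (b : Fin n) → sum (λ i → 𝟙 (i Fin.≟ b)) ≡ 1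
sum-𝟙-≟ {suc n} zero = cong suc (sum-zero {n} _ λ _ → refl)
sum-𝟙-≟ {suc n} (suc b) = trans (sum-cong-≗ {n} λ i → 𝟙-cong Fin.suc-injective (cong suc) (suc i Fin.≟ suc b) (i Fin.≟ b)) (sum-𝟙-≟ b)

sumL : (A → ℕ) → List A → ℕ
sumL f [] = 0
sumL f (x ∷ xs) = f x + sumL f xs

sumL-cong : ∀ {f g : A → ℕ} xs → (∀ x → f x ≡ g x) → sumL f xs ≡ sumL g xs
sumL-cong [] f≗g = refl
sumL-cong (x ∷ xs) f≗g = cong₂ _+_ (f≗g x) (sumL-cong xs f≗g)

sumL-++ : ∀ (f : A → ℕ) xs ys → sumL f (xs ++ ys) ≡ sumL f xs + sumL f ys
sumL-++ f [] ys = refl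
sumL-++ f (x ∷ xs) ys = trans (cong (f x +_) (sumL-++ f xs ys)) (sym (ℕ.+-assoc (f x) _ _))

sumL-map : ∀ (f : B → ℕ) (g : A → B) xs → sumL f (map g xs) ≡ sumL (f ∘ g) xs
sumL-map f g [] = refl
sumL-map f g (x ∷ xs) = cong (f (g x) +_) (sumL-map f g xs)

sumL-concatMap : ∀ (f : B → ℕ) (g : A → List B) xs → sumL f (concatMap g xs) ≡ sumL (λ x → sumL f (g x)) xs
sumL-concatMap f g [] = refl
sumL-concatMap f g (x ∷ xs) = trans (sumL-++ f (g x) (concatMap g xs)) (cong (sumL f (g x) +_) (sumL-concatMap f g xs))

*-distribˡ-sumL : ∀ c (f : A → ℕ) xs → c * sumL f xs ≡ sumL (λ x → c * f x) xs
*-distribˡ-sumL c f [] = ℕ.*-zeroʳ c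
*-distribˡ-sumL c f (x ∷ xs) = trans (ℕ.*-distribˡ-+ c (f x) _) (cong (c * f x +_) (*-distribˡ-sumL c f xs))

sumL-tabulate : ∀ {m} (f : A → ℕ) (g : Fin m → A) → sumL f (tabulate g) ≡ sum (f ∘ g)
sumL-tabulate {m = zero} f g = refl
sumL-tabulate {m = suc m} f g = cong (f (g zero) +_) (sumL-tabulate f (g ∘ suc))

length-filter≡sumL : ∀ {P : A → Set} (P? : ∀ x → Dec (P x)) xs → length (filter P? xs) ≡ sumL (λ x → 𝟙 (P? x)) xs
length-filter≡sumL P? [] = refl
length-filter≡sumL P? (x ∷ xs) with P? x
... | yes _ = cong suc (length-filter≡sumL P? xs)
... | no _ = length-filter≡sumL P? xs

≗-dec : DecidableEquality A → ∀ {k} (f g : Fin k → A) → Dec (∀ t → f t ≡ g t)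
≗-dec _≟_ f g = Fin.all? λ t → f t ≟ g t

module _ {A : Set} (_≟_ : DecidableEquality A) where

  private
    _≗?_ : ∀ {k} (f g : Fin k → A) → Dec (∀ t → f t ≡ g t)
    _≗?_ = ≗-dec _≟_

  allMaps-unique : ∀ k (xs : List A) → (∀ a → sumL (λ x → 𝟙 (x ≟ a)) xs ≡ 1) →
    ∀ (τ : Fin k → A) → sumL (λ f → 𝟙 (f ≗? τ)) (allMaps k xs) ≡ 1
  allMaps-unique zero xs xs-unique τ = cong (_+ 0) (𝟙-yes (λ ()) ((λ ()) ≗? τ))
  allMaps-unique (suc k) xs xs-unique τ = begin
    sumL (λ f → 𝟙 (f ≗? τ)) (concatMap (λ a → map (consF a) (allMaps k xs)) xs)
      ≡⟨ sumL-concatMap (λ f → 𝟙 (f ≗? τ)) (λ a → map (consF a) (allMaps k xs)) xs ⟩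
    sumL (λ a → sumL (λ f → 𝟙 (f ≗? τ)) (map (consF a) (allMaps k xs))) xs
      ≡⟨ sumL-cong xs (λ a → sumL-map (λ f → 𝟙 (f ≗? τ)) (consF a) (allMaps k xs)) ⟩
    sumL (λ a → sumL (λ f → 𝟙 (consF a f ≗? τ)) (allMaps k xs)) xs
      ≡⟨ sumL-cong xs (λ a → sumL-cong (allMaps k xs) λ f →
           𝟙-× (λ eq → eq zero , eq ∘ suc) (λ { (eq₀ , eqₛ) → λ { zero → eq₀ ; (suc t) → eqₛ t } })
               (consF a f ≗? τ) (a ≟ τ zero) (f ≗? (τ ∘ suc))) ⟩
    sumL (λ a → sumL (λ f → 𝟙 (a ≟ τ zero) * 𝟙 (f ≗? (τ ∘ suc))) (allMaps k xs)) xs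
      ≡⟨ sumL-cong xs (λ a → trans (sym (*-distribˡ-sumL (𝟙 (a ≟ τ zero)) (λ f → 𝟙 (f ≗? (τ ∘ suc))) (allMaps k xs)))
           (trans (cong (𝟙 (a ≟ τ zero) *_) (allMaps-unique k xs xs-unique (τ ∘ suc))) (ℕ.*-identityʳ (𝟙 (a ≟ τ zero))))) ⟩
    sumL (λ a → 𝟙 (a ≟ τ zero)) xs
      ≡⟨ xs-unique (τ zero) ⟩
    1 ∎
    where open ≡-Reasoning

_≟M_ : ∀ {n} → DecidableEquality (Maybe (Fin n))
_≟M_ = Maybe.≡-dec Fin._≟_

allMaybeFin-unique : ∀ n (a : Maybe (Fin n)) → sumL (λ x → 𝟙 (x ≟M a)) (allMaybeFin n) ≡ 1
allMaybeFin-unique n nothing = cong suc (trans (sumL-map (λ x → 𝟙 (x ≟M nothing)) just (allFin n))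
  (trans (sumL-tabulate {m = n} (λ x → 𝟙 (just x ≟M nothing)) id) (sum-zero {n} _ λ _ → refl)))
allMaybeFin-unique n (just b) = begin
  sumL (λ x → 𝟙 (x ≟M just b)) (map just (allFin n))   ≡⟨ sumL-map (λ x → 𝟙 (x ≟M just b)) just (allFin n) ⟩
  sumL (λ x → 𝟙 (just x ≟M just b)) (allFin n)        ≡⟨ sumL-tabulate (λ x → 𝟙 (just x ≟M just b)) id ⟩
  sum (λ x → 𝟙 (just x ≟M just b))                    ≡⟨ sum-cong-≗ (λ i → 𝟙-cong Maybe.just-injective (cong just) (just i ≟M just b) (i Fin.≟ b)) ⟩
  sum (λ x → 𝟙 (x Fin.≟ b))                           ≡⟨ sum-𝟙-≟ b ⟩
  1 ∎
  where open ≡-Reasoning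

perm-unique : ∀ {n} (π : Fin n → Fin n) → Inj π → ℕCode.∑Code (λ c → 𝟙 (≗-dec Fin._≟_ (perm c) π)) ≡ 1
perm-unique {zero} π _ = 𝟙-yes (λ ()) (≗-dec Fin._≟_ (perm _) π)
perm-unique {suc m} π π-inj = begin
  sum (λ j → ℕCode.∑Code (λ c → 𝟙 (≗-dec Fin._≟_ (perm {suc m} (j , c)) π)))
    ≡⟨ sum-cong-≗ (λ j → ℕCode.∑Code-cong λ c → 𝟙-× (split j c) (join j c)
         (≗-dec Fin._≟_ (perm {suc m} (j , c)) π) (j Fin.≟ π zero) (≗-dec Fin._≟_ (perm c) π′)) ⟩
  sum (λ j → ℕCode.∑Code (λ c → 𝟙 (j Fin.≟ π zero) * 𝟙 (≗-dec Fin._≟_ (perm c) π′)))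
    ≡⟨ sum-cong-≗ (λ j → trans (sym (ℕCode.*-distribˡ-∑Code (𝟙 (j Fin.≟ π zero)) λ c → 𝟙 (≗-dec Fin._≟_ (perm c) π′)))
                                (trans (cong (𝟙 (j Fin.≟ π zero) *_) (perm-unique π′ π′-inj)) (ℕ.*-identityʳ (𝟙 (j Fin.≟ π zero))))) ⟩
  sum (λ j → 𝟙 (j Fin.≟ π zero))
    ≡⟨ sum-𝟙-≟ (π zero) ⟩
  1 ∎
  where
  open ≡-Reasoning
  π0≢ : ∀ i → π zero ≢ π (suc i)
  π0≢ i = Fin.0≢1+n ∘ π-inj
  π′ : Fin m → Fin m
  π′ i = punchOut (π0≢ i)
  π′-inj : Inj π′
  π′-inj {x} {y} eq = Fin.suc-injective (π-inj (Fin.punchOut-injective (π0≢ x) (π0≢ y) eq))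
  split : ∀ j c → (∀ t → perm {suc m} (j , c) t ≡ π t) → j ≡ π zero × (∀ t → perm c t ≡ π′ t)
  split j c eq = eq zero , λ t → trans (sym (Fin.punchOut-punchIn (π zero)))
    (Fin.punchOut-cong (π zero) (trans (cong (λ x → punchIn x (perm c t)) (sym (eq zero))) (eq (suc t))))
  join : ∀ j c → j ≡ π zero × (∀ t → perm c t ≡ π′ t) → ∀ t → perm {suc m} (j , c) t ≡ π t
  join j c (eq₀ , eqₛ) zero = eq₀
  join j c (eq₀ , eqₛ) (suc t) = trans (cong₂ punchIn eq₀ (eqₛ t)) (Fin.punchIn-punchOut (π0≢ t))

∑Code-sumL-comm : ∀ {n} (F : A → Code n → ℕ) xs →
  ℕCode.∑Code (λ c → sumL (λ x → F x c) xs) ≡ sumL (λ x → ℕCode.∑Code (F x)) xs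
∑Code-sumL-comm {n = n} F [] = ℕCode.∑Code-zero {n} {λ _ → 0} λ _ → refl
∑Code-sumL-comm F (x ∷ xs) =
  trans (ℕCode.∑Code-distrib-+ (F x) (λ c → sumL (λ y → F y c) xs)) (cong (ℕCode.∑Code (F x) +_) (∑Code-sumL-comm F xs))

fixedPoints+moved : ∀ {n} (π : Fin n → Fin n) → fixedPoints π + moved π ≡ n
fixedPoints+moved {n} π = trans (sym (∑-distrib-+ (λ t → 𝟙 (π t Fin.≟ t)) (isMoved π))) (trans (sum-cong-≗ one) (ones n))
  where
  one : ∀ t → 𝟙 (π t Fin.≟ t) + isMoved π t ≡ 1
  one t with π t Fin.≟ t
  ... | yes _ = refl
  ... | no _ = refl
  ones : ∀ m → sum {m} (λ _ → 1) ≡ m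
  ones zero = refl
  ones (suc m) = cong suc (ones m)

order≡sum : ∀ {n} (σ : Fin n → Maybe (Fin n)) → order σ ≡ sum (λ t → 𝟙 (isJust? (σ t)))
order≡sum {n} σ = trans (length-filter≡sumL (λ t → isJust? (σ t)) (allFin n)) (sumL-tabulate (λ t → 𝟙 (isJust? (σ t))) id)

toSuccessor : ∀ {n} → (Fin n → Fin n) → Fin n → Maybe (Fin n)
toSuccessor π t with π t Fin.≟ t
... | yes _ = nothing
... | no _ = just (π t)

fromSuccessor : ∀ {n} → (Fin n → Maybe (Fin n)) → Fin n → Fin n
fromSuccessor σ t = fromMaybe t (σ t)

module _ {n} {π : Fin n → Fin n} where

  toSuccessor-fixed : ∀ {t} → π t ≡ t → toSuccessor π t ≡ nothing
  toSuccessor-fixed {t} πt≡t with π t Fin.≟ t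
  ... | yes _ = refl
  ... | no πt≢t = ⊥-elim (πt≢t πt≡t)

  toSuccessor-moved : ∀ {t} → π t ≢ t → toSuccessor π t ≡ just (π t)
  toSuccessor-moved {t} πt≢t with π t Fin.≟ t
  ... | yes πt≡t = ⊥-elim (πt≢t πt≡t)
  ... | no _ = refl

  fromSuccessor-toSuccessor : ∀ t → fromSuccessor (toSuccessor π) t ≡ π t
  fromSuccessor-toSuccessor t with π t Fin.≟ t
  ... | yes πt≡t = sym πt≡t
  ... | no _ = refl

  order-toSuccessor : order (toSuccessor π) ≡ moved π
  order-toSuccessor = trans (order≡sum (toSuccessor π)) (sum-cong-≗ isJust-toSuccessor)
    where
    isJust-toSuccessor : ∀ t → 𝟙 (isJust? (toSuccessor π t)) ≡ isMoved π t
    isJust-toSuccessor t with π t Fin.≟ t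
    ... | yes _ = refl
    ... | no _ = refl

fromSuccessor-on : ∀ {n} (σ : Fin n → Maybe (Fin n)) {t u} → σ t ≡ just u → fromSuccessor σ t ≡ u
fromSuccessor-on σ {t} = cong (fromMaybe t)

fromSuccessor-off : ∀ {n} (σ : Fin n → Maybe (Fin n)) {t} → σ t ≡ nothing → fromSuccessor σ t ≡ t
fromSuccessor-off σ {t} = cong (fromMaybe t)

toSuccessor-cong : ∀ {n} {π ρ : Fin n → Fin n} → (∀ t → π t ≡ ρ t) → ∀ t → toSuccessor π t ≡ toSuccessor ρ t
toSuccessor-cong {π = π} {ρ} π≗ρ t with π t Fin.≟ t
... | yes πt≡t = sym (toSuccessor-fixed (trans (sym (π≗ρ t)) πt≡t))
... | no πt≢t = trans (cong just (π≗ρ t)) (sym (toSuccessor-moved (πt≢t ∘ trans (π≗ρ t))))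

order-cong : ∀ {n} {σ σ′ : Fin n → Maybe (Fin n)} → (∀ t → σ t ≡ σ′ t) → order σ ≡ order σ′
order-cong {σ = σ} {σ′} σ≗σ′ =
  trans (order≡sum σ) (trans (sum-cong-≗ λ t → cong (λ x → 𝟙 (isJust? x)) (σ≗σ′ t)) (sym (order≡sum σ′)))

is-just-≡ : ∀ {A : Set} {x : Maybe A} {u} → x ≡ just u → Is-just x
is-just-≡ refl = just tt

is-just-≢-nothing : ∀ {A : Set} {x : Maybe A} → Is-just x → x ≢ nothing
is-just-≢-nothing (just _) ()

module _ {n} (S : SignedDigraph n) where

  OutArc : (Fin n → Maybe (Fin n)) → Fin n → Fin n → Set
  OutArc σ t u = Arc S t u × Is-just (σ u)

  IsLinear-cong : ∀ {σ σ′} → (∀ t → σ t ≡ σ′ t) → IsLinear S σ → IsLinear S σ′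
  IsLinear-cong {σ} {σ′} σ≗σ′ (out , heads-distinct , heads-cover) = out′ , heads-distinct′ , heads-cover′
    where
    out′ : ∀ t → MaybeAll.All (OutArc σ′ t) (σ′ t)
    out′ t = subst (MaybeAll.All (OutArc σ′ t)) (σ≗σ′ t) (MaybeAll.map (λ {u} (a , u∈) → a , subst Is-just (σ≗σ′ u) u∈) (out t))
    heads-distinct′ : ∀ t t′ → Is-just (σ′ t) → σ′ t ≡ σ′ t′ → t ≡ t′
    heads-distinct′ t t′ t∈ eq = heads-distinct t t′ (subst Is-just (sym (σ≗σ′ t)) t∈) (trans (σ≗σ′ t) (trans eq (sym (σ≗σ′ t′))))
    heads-cover′ : ∀ t → Is-just (σ′ t) → ∃ λ t′ → σ′ t′ ≡ just t
    heads-cover′ t t∈ with heads-cover t (subst Is-just (sym (σ≗σ′ t)) t∈)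
    ... | t′ , eq = t′ , trans (sym (σ≗σ′ t′)) eq

  arc-≢ : ∀ {t u} → Arc S t u → u ≢ t
  arc-≢ {t} a refl = is-just-≢-nothing a (loopless S t)

  out-arc : ∀ {σ t u} → σ t ≡ just u → IsLinear S σ → OutArc σ t u
  out-arc {σ} {t} σt≡u (out , _) = MaybeAll.drop-just (subst (MaybeAll.All (OutArc σ t)) σt≡u (out t))

  linear⇒supported : ∀ {π} → IsLinear S (toSuccessor π) → Supported S π
  linear⇒supported lin t πt≢t = proj₁ (out-arc (toSuccessor-moved πt≢t) lin)

  supported⇒linear : ∀ {π} → Inj π → Supported S π → IsLinear S (toSuccessor π)
  supported⇒linear {π} π-inj supp = out , heads-distinct , heads-cover
    where
    out : ∀ t → MaybeAll.All (OutArc (toSuccessor π) t) (toSuccessor π t)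
    out t with π t Fin.≟ t
    ... | yes _ = MaybeAll.nothing
    ... | no πt≢t = MaybeAll.just (supp t πt≢t , is-just-≡ (toSuccessor-moved (πt≢t ∘ π-inj)))
    heads-distinct : ∀ t t′ → Is-just (toSuccessor π t) → toSuccessor π t ≡ toSuccessor π t′ → t ≡ t′
    heads-distinct t t′ t∈ eq = by-cases (π t Fin.≟ t) (π t′ Fin.≟ t′)
      where
      by-cases : Dec (π t ≡ t) → Dec (π t′ ≡ t′) → t ≡ t′
      by-cases (yes πt≡t) _ = ⊥-elim (is-just-≢-nothing t∈ (toSuccessor-fixed πt≡t))
      by-cases (no πt≢t) (yes πt′≡t′) =
        ⊥-elim (is-just-≢-nothing (is-just-≡ (toSuccessor-moved πt≢t)) (trans eq (toSuccessor-fixed πt′≡t′)))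
      by-cases (no πt≢t) (no πt′≢t′) =
        π-inj (Maybe.just-injective (trans (sym (toSuccessor-moved πt≢t)) (trans eq (toSuccessor-moved πt′≢t′))))
    heads-cover : ∀ t → Is-just (toSuccessor π t) → ∃ λ t′ → toSuccessor π t′ ≡ just t
    heads-cover t t∈ with inj⇒surj π π-inj t
    ... | t′ , πt′≡t = t′ , trans (toSuccessor-moved πt′≢t′) (cong just πt′≡t)
      where
      πt′≢t′ : π t′ ≢ t′
      πt′≢t′ πt′≡t′ = is-just-≢-nothing t∈ (toSuccessor-fixed (trans (cong π (sym (trans (sym πt′≡t′) πt′≡t))) πt′≡t))

  toSuccessor-fromSuccessor : ∀ {σ} → IsLinear S σ → ∀ t → σ t ≡ toSuccessor (fromSuccessor σ) t
  toSuccessor-fromSuccessor {σ} lin t = by-cases (σ t) refl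
    where
    by-cases : ∀ m → σ t ≡ m → σ t ≡ toSuccessor (fromSuccessor σ) t
    by-cases nothing σt≡∅ = trans σt≡∅ (sym (toSuccessor-fixed (fromSuccessor-off σ σt≡∅)))
    by-cases (just u) σt≡u = trans σt≡u (sym (trans (toSuccessor-moved moves) (cong just (fromSuccessor-on σ σt≡u))))
      where
      moves : fromSuccessor σ t ≢ t
      moves eq = arc-≢ (proj₁ (out-arc σt≡u lin)) (trans (sym (fromSuccessor-on σ σt≡u)) eq)

  fromSuccessor-inj : ∀ {σ} → IsLinear S σ → Inj (fromSuccessor σ)
  fromSuccessor-inj {σ} lin@(_ , heads-distinct , _) {x} {y} eq = by-cases (σ x) (σ y) refl refl
    where
    by-cases : ∀ mx my → σ x ≡ mx → σ y ≡ my → x ≡ y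
    by-cases (just u) (just u′) σx≡u σy≡u′ = heads-distinct x y (is-just-≡ σx≡u)
      (trans σx≡u (trans (cong just (trans (sym (fromSuccessor-on σ σx≡u)) (trans eq (fromSuccessor-on σ σy≡u′)))) (sym σy≡u′)))
    by-cases (just u) nothing σx≡u σy≡∅ = ⊥-elim (is-just-≢-nothing
      (subst (Is-just ∘ σ) (trans (sym (fromSuccessor-on σ σx≡u)) (trans eq (fromSuccessor-off σ σy≡∅))) (proj₂ (out-arc σx≡u lin))) σy≡∅)
    by-cases nothing (just u′) σx≡∅ σy≡u′ = ⊥-elim (is-just-≢-nothing
      (subst (Is-just ∘ σ) (trans (sym (fromSuccessor-on σ σy≡u′)) (trans (sym eq) (fromSuccessor-off σ σx≡∅))) (proj₂ (out-arc σy≡u′ lin))) σx≡∅)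
    by-cases nothing nothing σx≡∅ σy≡∅ = trans (sym (fromSuccessor-off σ σx≡∅)) (trans eq (fromSuccessor-off σ σy≡∅))

  -- Along arcs colours alternate, so π maps the moved vertices of each colour onto those of the other.
  moved-even : Bipartite S → ∀ {π} → Inj π → Supported S π → ∃ λ h → moved π ≡ h + h
  moved-even (colour , proper) {π} π-inj supp = sum onSide₁ , (begin
    moved π                              ≡⟨ sum-cong-≗ split ⟩
    sum (λ t → onSide₁ t + onSide₂ t)    ≡⟨ ∑-distrib-+ onSide₁ onSide₂ ⟩
    sum onSide₁ + sum onSide₂            ≡⟨ cong (sum onSide₁ +_) (trans (sum-reindex onSide₂ π π-inj) (sum-cong-≗ swap-sides)) ⟩
    sum onSide₁ + sum onSide₁ ∎)
    where
    open ≡-Reasoning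
    bit : Bool → ℕ
    bit true = 1
    bit false = 0
    onSide₁ onSide₂ : Fin n → ℕ
    onSide₁ t = isMoved π t * bit (colour t)
    onSide₂ t = isMoved π t * bit (not (colour t))
    split : ∀ t → isMoved π t ≡ onSide₁ t + onSide₂ t
    split t with colour t
    ... | true = sym (trans (cong₂ _+_ (ℕ.*-identityʳ (isMoved π t)) (ℕ.*-zeroʳ (isMoved π t))) (ℕ.+-identityʳ (isMoved π t)))
    ... | false = sym (trans (cong (_+ isMoved π t * 1) (ℕ.*-zeroʳ (isMoved π t))) (ℕ.*-identityʳ (isMoved π t)))
    swap-sides : ∀ t → onSide₂ (π t) ≡ onSide₁ t
    swap-sides t = by-cases (π t Fin.≟ t)
      where
      by-cases : Dec (π t ≡ t) → onSide₂ (π t) ≡ onSide₁ t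
      by-cases (yes πt≡t) = trans (cong onSide₂ πt≡t) (trans (cong (_* bit (not (colour t))) (isMoved-fixed {π = π} πt≡t))
                                                             (sym (cong (_* bit (colour t)) (isMoved-fixed {π = π} πt≡t))))
      by-cases (no πt≢t) = cong₂ _*_ (trans (isMoved-moved {π = π} (πt≢t ∘ π-inj)) (sym (isMoved-moved {π = π} πt≢t)))
        (cong bit (trans (cong not (¬-not (proper t (π t) (supp t πt≢t) ∘ sym))) (not-involutive (colour t))))

sum≡0⇒≡0 : ∀ {n} (f : Fin n → ℕ) → sum f ≡ 0 → ∀ i → f i ≡ 0
sum≡0⇒≡0 f sum≡0 zero = ℕ.m+n≡0⇒m≡0 (f zero) sum≡0
sum≡0⇒≡0 f sum≡0 (suc i) = sum≡0⇒≡0 (f ∘ suc) (ℕ.m+n≡0⇒n≡0 (f zero) sum≡0) i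

fixedPoints≡n⇒id : ∀ {n} {π : Fin n → Fin n} → fixedPoints π ≡ n → ∀ t → π t ≡ t
fixedPoints≡n⇒id {n} {π} fp≡n t with π t Fin.≟ t
... | yes πt≡t = πt≡t
... | no πt≢t = ⊥-elim (ℕ.1+n≢0 (trans (sym (isMoved-moved {π = π} πt≢t)) (sum≡0⇒≡0 (isMoved π) moved≡0 t)))
  where
  moved≡0 : moved π ≡ 0
  moved≡0 = ℕ.+-cancelˡ-≡ n (moved π) 0 (trans (cong (_+ moved π) (sym fp≡n)) (trans (fixedPoints+moved π) (sym (ℕ.+-identityʳ n))))

moved≡0⇒fixedPoints≡n : ∀ {n} {π : Fin n → Fin n} → moved π ≡ 0 → fixedPoints π ≡ n
moved≡0⇒fixedPoints≡n {π = π} moved≡0 =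
  trans (sym (ℕ.+-identityʳ (fixedPoints π))) (trans (cong (fixedPoints π +_) (sym moved≡0)) (fixedPoints+moved π))

id⇒fixedPoints≡n : ∀ {n} {π : Fin n → Fin n} → (∀ t → π t ≡ t) → fixedPoints π ≡ n
id⇒fixedPoints≡n {π = π} π≗id = moved≡0⇒fixedPoints≡n (sum-zero (isMoved π) λ t → isMoved-fixed {π = π} (π≗id t))

module _ {n} (S : SignedDigraph n) where

  count-identity : ℕCode.∑Code (λ c → 𝟙 (countedWith? S n c)) ≡ 1
  count-identity = trans (ℕCode.∑Code-cong λ c → 𝟙-cong (to c) (from c) (countedWith? S n c) (≗-dec Fin._≟_ (perm c) id))
                         (perm-unique {n} id (λ eq → eq))
    where
    to : ∀ c → CountedWith S n c → ∀ t → perm c t ≡ t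
    to c (fp≡n , _) = fixedPoints≡n⇒id {π = perm c} fp≡n
    from : ∀ c → (∀ t → perm c t ≡ t) → CountedWith S n c
    from c perm≗id = id⇒fixedPoints≡n {π = perm c} perm≗id , λ t moves → ⊥-elim (moves (perm≗id t))

  uncounted : Bipartite S → ∀ {k} → k ≢ n → (∀ j → 1 ≤ j → 2 * j ≤ n → k ≢ n ∸ 2 * j) → ∀ c → ¬ CountedWith S k c
  uncounted bip {k} k≢n off-gap c (fp≡k , supp) with moved-even S bip (perm-inj c) supp
  ... | zero , moved≡0 = k≢n (trans (sym fp≡k) (moved≡0⇒fixedPoints≡n moved≡0))
  ... | suc h , moved≡2h = off-gap (suc h) (s≤s z≤n) 2j≤n (trans (sym fp≡k) fp≡n∸2j)
    where
    π : Fin n → Fin n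
    π = perm c
    moved≡2j : moved π ≡ 2 * suc h
    moved≡2j = trans moved≡2h (cong (suc h +_) (sym (ℕ.+-identityʳ (suc h))))
    total : fixedPoints π + 2 * suc h ≡ n
    total = trans (cong (fixedPoints π +_) (sym moved≡2j)) (fixedPoints+moved π)
    2j≤n : 2 * suc h ≤ n
    2j≤n = subst (2 * suc h ≤_) total (ℕ.m≤n+m (2 * suc h) (fixedPoints π))
    fp≡n∸2j : fixedPoints π ≡ n ∸ 2 * suc h
    fp≡n∸2j = trans (sym (ℕ.m+n∸n≡m (fixedPoints π) (2 * suc h))) (cong (_∸ 2 * suc h) total)

  LinearOfOrder : ℕ → (Fin n → Maybe (Fin n)) → Set
  LinearOfOrder m σ = IsLinear S σ × order σ ≡ m

  linearOfOrder? : ∀ m σ → Dec (LinearOfOrder m σ)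
  linearOfOrder? m σ = isLinear? S σ ×-dec (order σ ℕ.≟ m)

  counted⇔linear : ∀ {m} → m ≤ n → ∀ c → 𝟙 (countedWith? S (n ∸ m) c) ≡ 𝟙 (linearOfOrder? m (toSuccessor (perm c)))
  counted⇔linear {m} m≤n c = 𝟙-cong to from (countedWith? S (n ∸ m) c) (linearOfOrder? m (toSuccessor π))
    where
    π : Fin n → Fin n
    π = perm c
    to : CountedWith S (n ∸ m) c → LinearOfOrder m (toSuccessor π)
    to (fp≡n∸m , supp) = supported⇒linear S (perm-inj c) supp , (begin
      order (toSuccessor π)                       ≡⟨ order-toSuccessor {π = π} ⟩
      moved π                                     ≡⟨ ℕ.m+n∸m≡n (fixedPoints π) (moved π) ⟨
      fixedPoints π + moved π ∸ fixedPoints π     ≡⟨ cong₂ _∸_ (fixedPoints+moved π) fp≡n∸m ⟩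
      n ∸ (n ∸ m)                                 ≡⟨ ℕ.m∸[m∸n]≡n m≤n ⟩
      m ∎)
      where open ≡-Reasoning
    from : LinearOfOrder m (toSuccessor π) → CountedWith S (n ∸ m) c
    from (lin , order≡m) = (begin
      fixedPoints π                               ≡⟨ ℕ.m+n∸n≡m (fixedPoints π) (moved π) ⟨
      fixedPoints π + moved π ∸ moved π           ≡⟨ cong₂ _∸_ (fixedPoints+moved π) (trans (sym (order-toSuccessor {π = π})) order≡m) ⟩
      n ∸ m ∎) , linear⇒supported S lin
      where open ≡-Reasoning

  pair-indicator : ∀ m c σ → 𝟙 (linearOfOrder? m (toSuccessor (perm c))) * 𝟙 (≗-dec _≟M_ σ (toSuccessor (perm c)))
                           ≡ 𝟙 (linearOfOrder? m σ) * 𝟙 (≗-dec Fin._≟_ (perm c) (fromSuccessor σ))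
  pair-indicator m c σ with ≗-dec _≟M_ σ (toSuccessor (perm c))
  ... | yes σ≗τ = trans (ℕ.*-identityʳ (𝟙 (linearOfOrder? m (toSuccessor (perm c))))) (trans
        (𝟙-cong (λ (lin , o) → IsLinear-cong S (sym ∘ σ≗τ) lin , trans (order-cong σ≗τ) o)
                (λ (lin , o) → IsLinear-cong S σ≗τ lin , trans (order-cong (sym ∘ σ≗τ)) o)
                (linearOfOrder? m (toSuccessor (perm c))) (linearOfOrder? m σ))
        (sym (trans (cong (𝟙 (linearOfOrder? m σ) *_) (𝟙-yes perm≗ (≗-dec Fin._≟_ (perm c) (fromSuccessor σ))))
                    (ℕ.*-identityʳ (𝟙 (linearOfOrder? m σ))))))
    where
    perm≗ : ∀ t → perm c t ≡ fromSuccessor σ t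
    perm≗ t = sym (trans (cong (fromMaybe t) (σ≗τ t)) (fromSuccessor-toSuccessor {π = perm c} t))
  ... | no σ≉τ = trans (ℕ.*-zeroʳ (𝟙 (linearOfOrder? m (toSuccessor (perm c))))) (𝟙-× id id (no λ ((lin , _) , perm≗) → σ≉τ λ t →
        trans (toSuccessor-fromSuccessor S lin t) (toSuccessor-cong (sym ∘ perm≗) t)) (linearOfOrder? m σ) (≗-dec Fin._≟_ (perm c) (fromSuccessor σ)))

  codes-of-linear : ∀ m σ →
    ℕCode.∑Code (λ c → 𝟙 (linearOfOrder? m σ) * 𝟙 (≗-dec Fin._≟_ (perm c) (fromSuccessor σ))) ≡ 𝟙 (linearOfOrder? m σ)
  codes-of-linear m σ = trans (sym (ℕCode.*-distribˡ-∑Code (𝟙 (linearOfOrder? m σ)) λ c → 𝟙 (≗-dec Fin._≟_ (perm c) (fromSuccessor σ))))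
                              (by-cases (linearOfOrder? m σ))
    where
    by-cases : (q : Dec (LinearOfOrder m σ)) → 𝟙 q * ℕCode.∑Code (λ c → 𝟙 (≗-dec Fin._≟_ (perm c) (fromSuccessor σ))) ≡ 𝟙 q
    by-cases (yes (lin , _)) = trans (ℕ.+-identityʳ _) (perm-unique (fromSuccessor σ) (fromSuccessor-inj S lin))
    by-cases (no _) = refl

  -- Double counting of the pairs (c , σ) with perm c = fromSuccessor σ.
  count-linear : ∀ {m} → m ≤ n → ℕCode.∑Code (λ c → 𝟙 (countedWith? S (n ∸ m) c)) ≡ numLinear S m
  count-linear {m} m≤n = begin
    ℕCode.∑Code (λ c → 𝟙 (countedWith? S (n ∸ m) c))
      ≡⟨ ℕCode.∑Code-cong (counted⇔linear m≤n) ⟩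
    ℕCode.∑Code (λ c → 𝟙 (Q? (toSuccessor (perm c))))
      ≡⟨ ℕCode.∑Code-cong (λ c → pick (toSuccessor (perm c))) ⟩
    ℕCode.∑Code (λ c → sumL (λ σ → 𝟙 (Q? (toSuccessor (perm c))) * 𝟙 (≗-dec _≟M_ σ (toSuccessor (perm c)))) maps)
      ≡⟨ ℕCode.∑Code-cong (λ c → sumL-cong maps (pair-indicator m c)) ⟩
    ℕCode.∑Code (λ c → sumL (λ σ → 𝟙 (Q? σ) * 𝟙 (≗-dec Fin._≟_ (perm c) (fromSuccessor σ))) maps)
      ≡⟨ ∑Code-sumL-comm (λ σ c → 𝟙 (Q? σ) * 𝟙 (≗-dec Fin._≟_ (perm c) (fromSuccessor σ))) maps ⟩
    sumL (λ σ → ℕCode.∑Code (λ c → 𝟙 (Q? σ) * 𝟙 (≗-dec Fin._≟_ (perm c) (fromSuccessor σ)))) maps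
      ≡⟨ sumL-cong maps (codes-of-linear m) ⟩
    sumL (λ σ → 𝟙 (Q? σ)) maps
      ≡⟨ length-filter≡sumL Q? maps ⟨
    numLinear S m ∎
    where
    open ≡-Reasoning
    Q? : ∀ σ → Dec (LinearOfOrder m σ)
    Q? = linearOfOrder? m
    maps : List (Fin n → Maybe (Fin n))
    maps = allMaps n (allMaybeFin n)
    pick : ∀ τ → 𝟙 (Q? τ) ≡ sumL (λ σ → 𝟙 (Q? τ) * 𝟙 (≗-dec _≟M_ σ τ)) maps
    pick τ = trans (sym (trans (cong (𝟙 (Q? τ) *_) (allMaps-unique _≟M_ n (allMaybeFin n) (allMaybeFin-unique n) τ)) (ℕ.*-identityʳ (𝟙 (Q? τ)))))
                   (*-distribˡ-sumL (𝟙 (Q? τ)) (λ σ → 𝟙 (≗-dec _≟M_ σ τ)) maps)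

-- Opened only here: the prefix +_ would make the ℕ sections (x +_) above ambiguous.
open import Data.Integer using (+_)

theorem2p7 : ∀ (n : ℕ) (S : SignedDigraph n) → Bipartite S → AllCyclesNegative S →
    (coeff (charPoly S) n ≡ + 1)
    × (∀ j → 1 ≤ j → 2 * j ≤ n → coeff (charPoly S) (n ∸ 2 * j) ≡ + numLinear S (2 * j))
    × (∀ k → k ≢ n → (∀ j → 1 ≤ j → 2 * j ≤ n → k ≢ n ∸ 2 * j) → coeff (charPoly S) k ≡ + 0)
theorem2p7 n S bipartite neg =
    trans (count n) (cong +_ (count-identity S))
  , (λ j _ 2j≤n → trans (count (n ∸ 2 * j)) (cong +_ (count-linear S 2j≤n)))
  , (λ k k≢n off-gap → trans (count k) (cong +_ (ℕCode.∑Code-zero λ c →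
        𝟙-no (uncounted S bipartite k≢n off-gap c) (countedWith? S k c))))
  where
  count : ∀ k → coeff (charPoly S) k ≡ + ℕCode.∑Code (λ c → 𝟙 (countedWith? S k c))
  count = coeff-charPoly≡count S neg
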